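{- Let \[ C^{\geq}(x;p,1;v)=\sum_{n\ge1}x^n\sum_{w}p^{\mathrm{sper}(w)}v^{w_n}, \] where the inner sum is over all Catalan words $w=w_1\cdots w_n$ of length $n$ avoiding the pattern $(\geq,\geq)$. Then \[ C^{\geq}(x;p,1;v)=\frac{1+(1-2v)p^2x-2vp^3x^2-\sqrt{1-2p^2x+(p^4-4p^3)x^2}}{2\left((1-v)-p^2v(1-v)x+p^3v^2x^2\right)}. \]
   Context: A Catalan word of length $n\ge 0$ is a sequence $w=w_1\cdots w_n$ of non-negative integers with $w_1=0$ and $0\le w_i\le w_{i-1}+1$ for $i=2,\dots,n$. It avoids the pattern $(\geq,\geq)$ if there is no index $i$ with $w_i\ge w_{i+1}\ge w_{i+2}$. To $w$ is associated the polyomino $P(w)$ with $n$ bottom-aligned columns, the $i$-th column consisting of $w_i+1$ unit cells. $\mathrm{sper}(w)$ is half the perimeter of $P(w)$, the perimeter being the number of cell edges of $P(w)$ not shared with another cell of $P(w)$. -}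

module Defs where

open import Data.Bool using (Bool; true; false; _∧_; not)
open import Data.Nat using (ℕ; zero; suc; _∸_; _⊓_; _≡ᵇ_; _≤ᵇ_; ⌊_/2⌋)
open import Data.List using (List; []; _∷_; map; concatMap; upTo; filterᵇ; foldr; length)
import Data.Nat as N
open import Algebra.Bundles using (CommutativeRing)

steps : List ℕ → Bool
steps (a ∷ b ∷ r) = (b ≤ᵇ suc a) ∧ steps (b ∷ r)
steps _ = true

isCatalan : List ℕ → Bool
isCatalan [] = true
isCatalan (x ∷ xs) = (x ≡ᵇ 0) ∧ steps (x ∷ xs)

avoidsGeGe : List ℕ → Bool
avoidsGeGe (a ∷ b ∷ c ∷ r) = not ((b ≤ᵇ a) ∧ (c ≤ᵇ b)) ∧ avoidsGeGe (b ∷ c ∷ r)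
avoidsGeGe _ = true

listsOf : ℕ → ℕ → List (List ℕ)
listsOf zero b = [] ∷ []
listsOf (suc k) b = concatMap (λ x → map (x ∷_) (listsOf k b)) (upTo b)

-- all Catalan words of length n avoiding (≥,≥), each exactly once
-- (entries of a Catalan word of length n are ≤ n-1, so listsOf n n suffices)
avoiders : ℕ → List (List ℕ)
avoiders n = filterᵇ (λ w → isCatalan w ∧ avoidsGeGe w) (listsOf n n)

-- last letter w_n (0 for the empty word; only used for n ≥ 1)
lastLetter : List ℕ → ℕ
lastLetter [] = 0
lastLetter (x ∷ []) = x
lastLetter (_ ∷ xs) = lastLetter xs

-- The polyomino P(w): column i has w_i + 1 cells, bottom-aligned.

sumℕ : List ℕ → ℕ
sumℕ = foldr N._+_ 0

cells : List ℕ → ℕ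
cells w = sumℕ (map suc w)

-- number of (unordered) pairs of cells of P(w) sharing an edge:
-- within column i there are w_i such pairs; between columns i and i+1
-- there are min(w_i + 1, w_{i+1} + 1) such pairs.
horizAdj : List ℕ → ℕ
horizAdj (a ∷ b ∷ r) = (suc a ⊓ suc b) N.+ horizAdj (b ∷ r)
horizAdj _ = 0

sharedEdges : List ℕ → ℕ
sharedEdges w = sumℕ w N.+ horizAdj w

-- perimeter = number of cell edges not shared with another cell
--           = 4 * (#cells) - 2 * (#shared edges)
perimeter : List ℕ → ℕ
perimeter w = 4 N.* cells w ∸ 2 N.* sharedEdges w

sper : List ℕ → ℕ
sper w = ⌊ perimeter w /2⌋

module Series {c ℓ} (R : CommutativeRing c ℓ) where
  open CommutativeRing R

  PowerSeries : Set c
  PowerSeries = ℕ → Carrier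

  pow : Carrier → ℕ → Carrier
  pow a zero = 1#
  pow a (suc n) = a * pow a n

  sumR : List Carrier → Carrier
  sumR = foldr _+_ 0#

  two : Carrier
  two = 1# + 1#

  _⊛_ : PowerSeries → PowerSeries → PowerSeries
  (f ⊛ g) n = sumR (map (λ k → f k * g (n ∸ k)) (upTo (suc n)))

  _⊝_ : PowerSeries → PowerSeries → PowerSeries
  (f ⊝ g) n = f n - g n

  quad : Carrier → Carrier → Carrier → PowerSeries
  quad a0 a1 a2 zero = a0
  quad a0 a1 a2 (suc zero) = a1
  quad a0 a1 a2 (suc (suc zero)) = a2
  quad a0 a1 a2 (suc (suc (suc _))) = 0#

  Cgeq : Carrier → Carrier → PowerSeries
  Cgeq p v zero = 0#
  Cgeq p v (suc n) =
    sumR (map (λ w → pow p (sper w) * pow v (lastLetter w)) (avoiders (suc n)))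

  numer : Carrier → Carrier → PowerSeries
  numer p v = quad 1# ((1# - two * v) * pow p 2) (- (two * v * pow p 3))

  radicand : Carrier → Carrier → PowerSeries
  radicand p v = quad 1# (- (two * pow p 2)) (pow p 4 - two * two * pow p 3)

  denom : Carrier → Carrier → PowerSeries
  denom p v = quad (two * (1# - v)) (- (two * (pow p 2 * v * (1# - v))))
                   (two * (pow p 3 * pow v 2))

-- Avoiders are built letter by letter: y may follow a word ending in l iff y ≤ l + 1, and
-- y > l if the word already ends with a weak descent; appending y raises sper by 1 + (y ∸ l).
-- Tracking the last letter j and the shape of the last step gives recurrences for the series
-- c_j(x) of avoiders ending in j. They give c_{j+1} = E c_j with E = c_0, so Σ_j c_j = E/(1 - E),
-- and with E = x(p² + p·x p²(1 + Σ_j c_j)) this makes E a root of (E - p²x)(1 - E) = p³x²,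
-- i.e. S = 1 + p²x - 2E squares to the radicand. Splitting C = Σ_j c_j v^j as C = A + B by the
-- last step, A = x p²(1 + v C) and (1 - v) B = x p (A(1) - v A); eliminating A and B gives
-- denom · C = numer - S.

module Submission where

open import Level using (Level)
open import Algebra.Bundles using (CommutativeRing; CommutativeMonoid)
open import Data.Bool using (Bool; true; false; _∧_; not)
import Data.Bool.Properties as 𝔹
open import Data.Integer as ℤ using (ℤ; +_; -[1+_]; _⊖_)
import Data.Integer.Properties as ℤ
open import Data.List using (List; []; _∷_; _∷ʳ_; _++_; map; upTo; applyUpTo; filterᵇ; concatMap)
open import Data.Maybe using (Maybe; just; nothing)
open import Data.Nat as ℕ using (ℕ; zero; suc; _≤_; _<_; z≤n; s≤s; _≤ᵇ_; _∸_)
import Data.Nat.Properties as ℕ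
open import Data.Product using (Σ; _×_; _,_)
open import Data.Sum using (inj₁; inj₂)
open import Data.Sign as Sign using (Sign)
open import Function using (_∘_; Equivalence)
open import Relation.Binary.PropositionalEquality as ≡ using (_≡_)
open import Relation.Nullary using (yes; no)

open import Defs

≤ᵇ-suc : ∀ m n → (suc m ≤ᵇ suc n) ≡ (m ≤ᵇ n)
≤ᵇ-suc zero n = ≡.refl
≤ᵇ-suc (suc m) n = ≡.refl

m≤n⇒1+n≤ᵇm≡false : ∀ {m n} → m ≤ n → (suc n ≤ᵇ m) ≡ false
m≤n⇒1+n≤ᵇm≡false z≤n = ≡.refl
m≤n⇒1+n≤ᵇm≡false {suc m} {suc n} (s≤s m≤n) = ≡.trans (≤ᵇ-suc (suc n) m) (m≤n⇒1+n≤ᵇm≡false m≤n)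

-- With coefficients in ℤ rather than in R itself, the solver can cancel terms such as x - x.
module IntegerSolver {c ℓ} (R : CommutativeRing c ℓ) where
  open CommutativeRing R hiding (zero)
  open import Algebra.Properties.Semiring.Mult.TCOptimised semiring
    using (1+×; ×-homo-+; ×1-homo-*) renaming (_×_ to _×ᵣ_)
  open import Algebra.Properties.Ring ring using (-0#≈0#; -‿involutive; -‿+-comm; -1*x≈-x; -‿distribʳ-*)
  import Algebra.Properties.CommutativeSemigroup as CommutativeSemigroupProperties
  module + = CommutativeSemigroupProperties +-commutativeSemigroup
  module * = CommutativeSemigroupProperties *-commutativeSemigroup
  open import Algebra.Solver.Ring.AlmostCommutativeRing
    using (AlmostCommutativeRing; fromCommutativeRing; _-Raw-AlmostCommutative⟶_)
  open import Relation.Binary.Reasoning.Setoid setoid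

  ⟦_⟧ℤ : ℤ → Carrier
  ⟦ + n ⟧ℤ = n ×ᵣ 1#
  ⟦ -[1+ n ] ⟧ℤ = - (suc n ×ᵣ 1#)

  ⊖-homo : ∀ m n → ⟦ m ⊖ n ⟧ℤ ≈ m ×ᵣ 1# - n ×ᵣ 1#
  ⊖-homo m zero = sym (trans (+-congˡ -0#≈0#) (+-identityʳ _))
  ⊖-homo zero (suc n) = sym (+-identityˡ _)
  ⊖-homo (suc m) (suc n) = begin
    ⟦ suc m ⊖ suc n ⟧ℤ              ≡⟨ ≡.cong ⟦_⟧ℤ (ℤ.[1+m]⊖[1+n]≡m⊖n m n) ⟩
    ⟦ m ⊖ n ⟧ℤ                      ≈⟨ ⊖-homo m n ⟩
    M - N                           ≈⟨ sym (+-identityˡ _) ⟩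
    0# + (M - N)                    ≈⟨ +-congʳ (sym (-‿inverseʳ 1#)) ⟩
    (1# - 1#) + (M - N)             ≈⟨ +.interchange 1# (- 1#) M (- N) ⟩
    (1# + M) + (- 1# - N)           ≈⟨ +-cong (sym (1+× m 1#)) (trans (-‿+-comm 1# N) (-‿cong (sym (1+× n 1#)))) ⟩
    suc m ×ᵣ 1# - suc n ×ᵣ 1#       ∎
    where
    M = m ×ᵣ 1#
    N = n ×ᵣ 1#

  +-homo : ∀ i j → ⟦ i ℤ.+ j ⟧ℤ ≈ ⟦ i ⟧ℤ + ⟦ j ⟧ℤ
  +-homo -[1+ m ] -[1+ n ] = begin
    - (suc (suc (m ℕ.+ n)) ×ᵣ 1#)            ≡⟨ ≡.cong (λ k → - (suc k ×ᵣ 1#)) (≡.sym (ℕ.+-suc m n)) ⟩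
    - ((suc m ℕ.+ suc n) ×ᵣ 1#)              ≈⟨ -‿cong (×-homo-+ 1# (suc m) (suc n)) ⟩
    - (suc m ×ᵣ 1# + suc n ×ᵣ 1#)             ≈⟨ sym (-‿+-comm _ _) ⟩
    - (suc m ×ᵣ 1#) - (suc n ×ᵣ 1#)           ∎
  +-homo -[1+ m ] (+ n) = trans (⊖-homo n (suc m)) (+-comm _ _)
  +-homo (+ m) -[1+ n ] = ⊖-homo m (suc n)
  +-homo (+ m) (+ n) = ×-homo-+ 1# m n

  ⟦_⟧± : Sign → Carrier
  ⟦ Sign.+ ⟧± = 1#
  ⟦ Sign.- ⟧± = - 1#

  ◃-homo : ∀ s n → ⟦ s ℤ.◃ n ⟧ℤ ≈ ⟦ s ⟧± * (n ×ᵣ 1#)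
  ◃-homo s zero = sym (zeroʳ _)
  ◃-homo Sign.+ (suc n) = sym (*-identityˡ _)
  ◃-homo Sign.- (suc n) = sym (-1*x≈-x _)

  sign-abs-homo : ∀ i → ⟦ i ⟧ℤ ≈ ⟦ ℤ.sign i ⟧± * (ℤ.∣ i ∣ ×ᵣ 1#)
  sign-abs-homo (+ n) = sym (*-identityˡ _)
  sign-abs-homo -[1+ n ] = sym (-1*x≈-x _)

  sign-*-homo : ∀ s t → ⟦ s Sign.* t ⟧± ≈ ⟦ s ⟧± * ⟦ t ⟧±
  sign-*-homo Sign.+ t = sym (*-identityˡ _)
  sign-*-homo Sign.- Sign.+ = sym (*-identityʳ _)
  sign-*-homo Sign.- Sign.- = begin
    1#              ≈⟨ sym (-‿involutive 1#) ⟩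
    - - 1#          ≈⟨ -‿cong (sym (-1*x≈-x 1#)) ⟩
    - (- 1# * 1#)   ≈⟨ -‿distribʳ-* (- 1#) 1# ⟩
    - 1# * - 1#     ∎

  *-homo : ∀ i j → ⟦ i ℤ.* j ⟧ℤ ≈ ⟦ i ⟧ℤ * ⟦ j ⟧ℤ
  *-homo i j = begin
    ⟦ i ℤ.* j ⟧ℤ                                      ≈⟨ ◃-homo (s Sign.* t) (∣i∣ ℕ.* ∣j∣) ⟩
    ⟦ s Sign.* t ⟧± * ((∣i∣ ℕ.* ∣j∣) ×ᵣ 1#)            ≈⟨ *-cong (sign-*-homo s t) (×1-homo-* ∣i∣ ∣j∣) ⟩
    (⟦ s ⟧± * ⟦ t ⟧±) * ((∣i∣ ×ᵣ 1#) * (∣j∣ ×ᵣ 1#))    ≈⟨ *.interchange _ _ _ _ ⟩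
    (⟦ s ⟧± * (∣i∣ ×ᵣ 1#)) * (⟦ t ⟧± * (∣j∣ ×ᵣ 1#))    ≈⟨ *-cong (sign-abs-homo i) (sign-abs-homo j) ⟨
    ⟦ i ⟧ℤ * ⟦ j ⟧ℤ                                   ∎
    where
    s = ℤ.sign i
    t = ℤ.sign j
    ∣i∣ = ℤ.∣ i ∣
    ∣j∣ = ℤ.∣ j ∣

  -‿homo : ∀ i → ⟦ ℤ.- i ⟧ℤ ≈ - ⟦ i ⟧ℤ
  -‿homo (+ zero) = sym -0#≈0#
  -‿homo (+ suc n) = refl
  -‿homo -[1+ n ] = sym (-‿involutive _)

  almostCommutativeRing : AlmostCommutativeRing c ℓ
  almostCommutativeRing = fromCommutativeRing R

  ℤ⟶R : ℤ.+-*-rawRing -Raw-AlmostCommutative⟶ almostCommutativeRing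
  ℤ⟶R = record
    { ⟦_⟧ = ⟦_⟧ℤ ; +-homo = +-homo ; *-homo = *-homo ; -‿homo = -‿homo
    ; 0-homo = refl ; 1-homo = refl }

  ⟦⟧ℤ-≟ : ∀ i j → Maybe (⟦ i ⟧ℤ ≈ ⟦ j ⟧ℤ)
  ⟦⟧ℤ-≟ i j with i ℤ.≟ j
  ... | yes ≡.refl = just refl
  ... | no _ = nothing

  open import Algebra.Solver.Ring ℤ.+-*-rawRing almostCommutativeRing ℤ⟶R ⟦⟧ℤ-≟ public

module FiniteSums {c ℓ} (R : CommutativeRing c ℓ) where
  open CommutativeRing R hiding (zero)
  open Series R using (sumR)
  open import Algebra.Properties.CommutativeSemigroup +-commutativeSemigroup using (interchange)
  open import Relation.Binary.Reasoning.Setoid setoid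

  ∑< : ℕ → (ℕ → Carrier) → Carrier
  ∑< zero f = 0#
  ∑< (suc n) f = f 0 + ∑< n (f ∘ suc)

  infixl 10 ∑<
  syntax ∑< n (λ i → x) = ∑[ i < n ] x

  ∑-cong-< : ∀ n {f g} → (∀ i → i < n → f i ≈ g i) → ∑< n f ≈ ∑< n g
  ∑-cong-< zero f≈g = refl
  ∑-cong-< (suc n) f≈g = +-cong (f≈g 0 (s≤s z≤n)) (∑-cong-< n (λ i i<n → f≈g (suc i) (s≤s i<n)))

  ∑-cong : ∀ n {f g} → (∀ i → f i ≈ g i) → ∑< n f ≈ ∑< n g
  ∑-cong n f≈g = ∑-cong-< n (λ i _ → f≈g i)

  ∑-≈0 : ∀ n {f} → (∀ i → i < n → f i ≈ 0#) → ∑< n f ≈ 0#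
  ∑-≈0 zero f≈0 = refl
  ∑-≈0 (suc n) f≈0 =
    trans (+-cong (f≈0 0 (s≤s z≤n)) (∑-≈0 n (λ i i<n → f≈0 (suc i) (s≤s i<n)))) (+-identityˡ 0#)

  ∑-+ : ∀ n f g → ∑[ i < n ] (f i + g i) ≈ ∑< n f + ∑< n g
  ∑-+ zero f g = sym (+-identityˡ 0#)
  ∑-+ (suc n) f g = trans (+-congˡ (∑-+ n (f ∘ suc) (g ∘ suc))) (interchange _ _ _ _)

  ∑-swap : ∀ m n (f : ℕ → ℕ → Carrier) → ∑[ i < m ] ∑[ j < n ] f i j ≈ ∑[ j < n ] ∑[ i < m ] f i j
  ∑-swap zero n f = sym (∑-≈0 n (λ _ _ → refl))
  ∑-swap (suc m) n f = trans (+-congˡ (∑-swap m n (f ∘ suc))) (sym (∑-+ n (f 0) _))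

  *-distribˡ-∑ : ∀ n a f → a * ∑< n f ≈ ∑[ i < n ] (a * f i)
  *-distribˡ-∑ zero a f = zeroʳ a
  *-distribˡ-∑ (suc n) a f = trans (distribˡ a _ _) (+-congˡ (*-distribˡ-∑ n a (f ∘ suc)))

  *-distribʳ-∑ : ∀ n a f → ∑< n f * a ≈ ∑[ i < n ] (f i * a)
  *-distribʳ-∑ n a f = begin
    ∑< n f * a             ≈⟨ *-comm _ a ⟩
    a * ∑< n f             ≈⟨ *-distribˡ-∑ n a f ⟩
    ∑[ i < n ] (a * f i)   ≈⟨ ∑-cong n (λ i → *-comm a (f i)) ⟩
    ∑[ i < n ] (f i * a)   ∎

  -‿distrib-∑ : ∀ n f → - ∑< n f ≈ ∑[ i < n ] (- f i)
  -‿distrib-∑ zero f = -0#≈0#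
    where open import Algebra.Properties.Ring ring using (-0#≈0#)
  -‿distrib-∑ (suc n) f = trans (sym (-‿+-comm _ _)) (+-congˡ (-‿distrib-∑ n (f ∘ suc)))
    where open import Algebra.Properties.Ring ring using (-‿+-comm)

  ∑-init-last : ∀ n f → ∑< (suc n) f ≈ ∑< n f + f n
  ∑-init-last zero f = trans (+-identityʳ _) (sym (+-identityˡ _))
  ∑-init-last (suc n) f = trans (+-congˡ (∑-init-last n (f ∘ suc))) (sym (+-assoc _ _ _))

  ∑-extend : ∀ n m {f} → n ≤ m → (∀ i → n ≤ i → f i ≈ 0#) → ∑< m f ≈ ∑< n f
  ∑-extend zero m _ f≈0 = ∑-≈0 m (λ i _ → f≈0 i z≤n)
  ∑-extend (suc n) (suc m) (s≤s n≤m) f≈0 = +-congˡ (∑-extend n m n≤m (λ i n≤i → f≈0 (suc i) (s≤s n≤i)))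

  [_] : Bool → Carrier
  [ true ] = 1#
  [ false ] = 0#

  [∧] : ∀ a b → [ a ∧ b ] ≈ [ a ] * [ b ]
  [∧] true b = sym (*-identityˡ _)
  [∧] false b = sym (zeroˡ _)

  ∑-[≤ᵇ] : ∀ m N (f : ℕ → Carrier) → m < N → ∑[ i < N ] ([ i ≤ᵇ m ] * f i) ≈ ∑< (suc m) f
  ∑-[≤ᵇ] zero (suc N) f _ = +-cong (*-identityˡ _) (∑-≈0 N (λ i _ → zeroˡ _))
  ∑-[≤ᵇ] (suc m) (suc N) f (s≤s m<N) = +-cong (*-identityˡ _)
    (trans (∑-cong N (λ i → *-congʳ (reflexive (≡.cong [_] (≤ᵇ-suc i m))))) (∑-[≤ᵇ] m N (f ∘ suc) m<N))

  ∑-select-suc : ∀ l N (f : ℕ → Carrier) → suc l < N →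
                 ∑[ y < N ] ([ (y ≤ᵇ suc l) ∧ not (y ≤ᵇ l) ] * f y) ≈ f (suc l)
  ∑-select-suc zero (suc (suc N)) f _ =
    trans (+-cong (zeroˡ _) (+-cong (*-identityˡ _) (∑-≈0 N (λ i _ → zeroˡ _))))
          (trans (+-identityˡ _) (+-identityʳ _))
  ∑-select-suc zero (suc zero) f (s≤s ())
  ∑-select-suc (suc l) (suc N) f (s≤s l<N) = trans (+-cong (zeroˡ _) shifted) (+-identityˡ _)
    where
    shifted = trans (∑-cong N (λ i → *-congʳ (reflexive (≡.cong₂ (λ a b → [ a ∧ not b ])
                                                          (≤ᵇ-suc i (suc l)) (≤ᵇ-suc i l)))))
                    (∑-select-suc l N (f ∘ suc) l<N)

  ∑-[≥ᵇ] : ∀ s n (f : ℕ → Carrier) → (∀ i → n ≤ i → f i ≈ 0#) →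
           ∑[ i < n ] ([ s ≤ᵇ i ] * f i) ≈ ∑[ i < n ] f (s ℕ.+ i)
  ∑-[≥ᵇ] zero n f _ = ∑-cong n (λ i → *-identityˡ _)
  ∑-[≥ᵇ] (suc s) zero f _ = refl
  ∑-[≥ᵇ] (suc s) (suc n) f f≈0 = begin
    0# * f 0 + ∑[ i < n ] ([ suc s ≤ᵇ suc i ] * f (suc i))
      ≈⟨ +-cong (zeroˡ _) (∑-cong n (λ i → *-congʳ (reflexive (≡.cong [_] (≤ᵇ-suc s i))))) ⟩
    0# + ∑[ i < n ] ([ s ≤ᵇ i ] * f (suc i))
      ≈⟨ +-congˡ (∑-[≥ᵇ] s n (f ∘ suc) (λ i n≤i → f≈0 (suc i) (s≤s n≤i))) ⟩
    0# + ∑[ i < n ] f (suc s ℕ.+ i)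
      ≈⟨ +-identityˡ _ ⟩
    ∑[ i < n ] f (suc s ℕ.+ i)
      ≈⟨ sym (∑-extend n (suc n) (ℕ.n≤1+n n) (λ i n≤i → f≈0 (suc s ℕ.+ i) (s≤s (ℕ.≤-trans n≤i (ℕ.m≤n+m i s))))) ⟩
    ∑[ i < suc n ] f (suc s ℕ.+ i)
      ∎

  sumR-applyUpTo : ∀ (f : ℕ → Carrier) g n → sumR (map f (applyUpTo g n)) ≡ ∑[ i < n ] f (g i)
  sumR-applyUpTo f g zero = ≡.refl
  sumR-applyUpTo f g (suc n) = ≡.cong (λ s → f (g 0) + s) (sumR-applyUpTo f (g ∘ suc) n)

  sumR-upTo : ∀ (f : ℕ → Carrier) n → sumR (map f (upTo n)) ≡ ∑< n f
  sumR-upTo f = sumR-applyUpTo f (λ i → i)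

  sumR-cong : ∀ {A : Set} {f g : A → Carrier} xs → (∀ x → f x ≈ g x) → sumR (map f xs) ≈ sumR (map g xs)
  sumR-cong [] f≈g = refl
  sumR-cong (x ∷ xs) f≈g = +-cong (f≈g x) (sumR-cong xs f≈g)

  sumR-++ : ∀ {A : Set} (f : A → Carrier) xs ys → sumR (map f (xs ++ ys)) ≈ sumR (map f xs) + sumR (map f ys)
  sumR-++ f [] ys = sym (+-identityˡ _)
  sumR-++ f (x ∷ xs) ys = trans (+-congˡ (sumR-++ f xs ys)) (sym (+-assoc _ _ _))

  sumR-concatMap : ∀ {A B : Set} (f : B → Carrier) (h : A → List B) xs →
                   sumR (map f (concatMap h xs)) ≈ sumR (map (λ x → sumR (map f (h x))) xs)
  sumR-concatMap f h [] = refl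
  sumR-concatMap f h (x ∷ xs) = trans (sumR-++ f (h x) (concatMap h xs)) (+-congˡ (sumR-concatMap f h xs))

  sumR-filterᵇ : ∀ {A : Set} (q : A → Bool) (f : A → Carrier) xs →
                 sumR (map f (filterᵇ q xs)) ≈ sumR (map (λ x → [ q x ] * f x) xs)
  sumR-filterᵇ q f [] = refl
  sumR-filterᵇ q f (x ∷ xs) with q x
  ... | true = +-cong (sym (*-identityˡ _)) (sumR-filterᵇ q f xs)
  ... | false = trans (sumR-filterᵇ q f xs) (sym (trans (+-congʳ (zeroˡ _)) (+-identityˡ _)))

module Words where
  open import Data.Nat using (_+_; _*_; _⊓_; _≡ᵇ_; ⌊_/2⌋)
  open import Data.Nat.Tactic.RingSolver using (solve-∀)
  open import Algebra.Properties.CommutativeSemigroup (CommutativeMonoid.commutativeSemigroup 𝔹.∧-commutativeMonoid)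
    using (interchange)
  open ≡.≡-Reasoning

  endsWeaklyDown : List ℕ → Bool
  endsWeaklyDown (a ∷ b ∷ []) = b ≤ᵇ a
  endsWeaklyDown (a ∷ b ∷ c ∷ r) = endsWeaklyDown (b ∷ c ∷ r)
  endsWeaklyDown _ = false

  isAvoider : List ℕ → Bool
  isAvoider w = isCatalan w ∧ avoidsGeGe w

  appendable : ℕ → Bool → ℕ → Bool
  appendable l d y = (y ≤ᵇ suc l) ∧ not (d ∧ (y ≤ᵇ l))

  lastLetter-∷ʳ : ∀ x xs y → lastLetter ((x ∷ xs) ∷ʳ y) ≡ y
  lastLetter-∷ʳ x [] y = ≡.refl
  lastLetter-∷ʳ x (z ∷ zs) y = lastLetter-∷ʳ z zs y

  endsWeaklyDown-∷ʳ : ∀ x xs y → endsWeaklyDown ((x ∷ xs) ∷ʳ y) ≡ (y ≤ᵇ lastLetter (x ∷ xs))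
  endsWeaklyDown-∷ʳ x [] y = ≡.refl
  endsWeaklyDown-∷ʳ x (z ∷ []) y = ≡.refl
  endsWeaklyDown-∷ʳ x (z ∷ z′ ∷ zs) y = endsWeaklyDown-∷ʳ z (z′ ∷ zs) y

  steps-∷ʳ : ∀ x xs y → steps ((x ∷ xs) ∷ʳ y) ≡ steps (x ∷ xs) ∧ (y ≤ᵇ suc (lastLetter (x ∷ xs)))
  steps-∷ʳ x [] y = 𝔹.∧-identityʳ _
  steps-∷ʳ x (z ∷ zs) y =
    ≡.trans (≡.cong ((z ≤ᵇ suc x) ∧_) (steps-∷ʳ z zs y)) (≡.sym (𝔹.∧-assoc (z ≤ᵇ suc x) _ _))

  avoidsGeGe-∷ʳ : ∀ x xs y → avoidsGeGe ((x ∷ xs) ∷ʳ y) ≡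
    avoidsGeGe (x ∷ xs) ∧ not (endsWeaklyDown (x ∷ xs) ∧ (y ≤ᵇ lastLetter (x ∷ xs)))
  avoidsGeGe-∷ʳ x [] y = ≡.refl
  avoidsGeGe-∷ʳ x (z ∷ []) y = 𝔹.∧-identityʳ _
  avoidsGeGe-∷ʳ x (z ∷ z′ ∷ zs) y =
    ≡.trans (≡.cong (not ((z ≤ᵇ x) ∧ (z′ ≤ᵇ z)) ∧_) (avoidsGeGe-∷ʳ z (z′ ∷ zs) y))
            (≡.sym (𝔹.∧-assoc (not ((z ≤ᵇ x) ∧ (z′ ≤ᵇ z))) _ _))

  isAvoider-∷ʳ : ∀ x xs y → isAvoider ((x ∷ xs) ∷ʳ y) ≡
    isAvoider (x ∷ xs) ∧ appendable (lastLetter (x ∷ xs)) (endsWeaklyDown (x ∷ xs)) y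
  isAvoider-∷ʳ x xs y = begin
    ((x ≡ᵇ 0) ∧ steps ((x ∷ xs) ∷ʳ y)) ∧ avoidsGeGe ((x ∷ xs) ∷ʳ y)
      ≡⟨ ≡.cong₂ (λ s a → ((x ≡ᵇ 0) ∧ s) ∧ a) (steps-∷ʳ x xs y) (avoidsGeGe-∷ʳ x xs y) ⟩
    ((x ≡ᵇ 0) ∧ (s ∧ u)) ∧ (a ∧ v)
      ≡⟨ ≡.cong (_∧ (a ∧ v)) (≡.sym (𝔹.∧-assoc (x ≡ᵇ 0) s u)) ⟩
    (((x ≡ᵇ 0) ∧ s) ∧ u) ∧ (a ∧ v)
      ≡⟨ interchange ((x ≡ᵇ 0) ∧ s) u a v ⟩
    (((x ≡ᵇ 0) ∧ s) ∧ a) ∧ (u ∧ v)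
      ∎
    where
    s = steps (x ∷ xs)
    a = avoidsGeGe (x ∷ xs)
    u = y ≤ᵇ suc (lastLetter (x ∷ xs))
    v = not (endsWeaklyDown (x ∷ xs) ∧ (y ≤ᵇ lastLetter (x ∷ xs)))

  -- Half the perimeter of P(a ∷ r), read column by column: the width, every drop a ∸ b
  -- between neighbouring columns, and the height of the last column.
  halfPerimeter : ℕ → List ℕ → ℕ
  halfPerimeter a [] = suc (suc a)
  halfPerimeter a (b ∷ r) = suc (halfPerimeter b r + (a ∸ b))

  edge-count : ∀ a r → 4 * cells (a ∷ r) ≡ 2 * sharedEdges (a ∷ r) + 2 * halfPerimeter a r
  edge-count a [] = column a
    where
    column : ∀ a → 4 * (suc a + 0) ≡ 2 * ((a + 0) + 0) + 2 * suc (suc a)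
    column = solve-∀
  edge-count a (b ∷ r) = begin
    4 * (suc a + cells (b ∷ r))
      ≡⟨ ≡.cong (λ z → 4 * (suc z + cells (b ∷ r))) (≡.sym a≡M+D) ⟩
    4 * (suc (M + D) + cells (b ∷ r))
      ≡⟨ ℕ.*-distribˡ-+ 4 (suc (M + D)) (cells (b ∷ r)) ⟩
    4 * suc (M + D) + 4 * cells (b ∷ r)
      ≡⟨ ≡.cong (λ z → 4 * suc (M + D) + z) (edge-count b r) ⟩
    4 * suc (M + D) + (2 * (sumℕ (b ∷ r) + horizAdj (b ∷ r)) + 2 * halfPerimeter b r)
      ≡⟨ regroup M D (sumℕ (b ∷ r)) (horizAdj (b ∷ r)) (halfPerimeter b r) ⟩
    2 * (((M + D) + sumℕ (b ∷ r)) + (suc M + horizAdj (b ∷ r))) + 2 * suc (halfPerimeter b r + D)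
      ≡⟨ ≡.cong (λ z → 2 * ((z + sumℕ (b ∷ r)) + (suc M + horizAdj (b ∷ r))) + 2 * suc (halfPerimeter b r + D))
                a≡M+D ⟩
    2 * sharedEdges (a ∷ b ∷ r) + 2 * halfPerimeter a (b ∷ r)
      ∎
    where
    M = a ⊓ b
    D = a ∸ b
    a≡M+D : M + D ≡ a
    a≡M+D = ≡.trans (≡.cong (_+ D) (ℕ.⊓-comm a b)) (ℕ.m⊓n+n∸m≡n b a)
    regroup : ∀ M D S H P → 4 * suc (M + D) + (2 * (S + H) + 2 * P) ≡
              2 * (((M + D) + S) + (suc M + H)) + 2 * suc (P + D)
    regroup = solve-∀

  sper-∷ : ∀ a r → sper (a ∷ r) ≡ halfPerimeter a r
  sper-∷ a r = begin
    ⌊ 4 * cells (a ∷ r) ∸ 2 * E /2⌋             ≡⟨ ≡.cong (λ z → ⌊ z ∸ 2 * E /2⌋) (edge-count a r) ⟩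
    ⌊ 2 * E + 2 * H ∸ 2 * E /2⌋                 ≡⟨ ≡.cong ⌊_/2⌋ (ℕ.m+n∸m≡n (2 * E) (2 * H)) ⟩
    ⌊ 2 * H /2⌋                                 ≡⟨ ≡.cong ⌊_/2⌋ (double H) ⟩
    ⌊ H + H /2⌋                                 ≡⟨ ≡.sym (ℕ.n≡⌊n+n/2⌋ H) ⟩
    H                                           ∎
    where
    E = sharedEdges (a ∷ r)
    H = halfPerimeter a r
    double : ∀ n → 2 * n ≡ n + n
    double = solve-∀

  m+[n∸m]≡n+[m∸n] : ∀ m n → m + (n ∸ m) ≡ n + (m ∸ n)
  m+[n∸m]≡n+[m∸n] m zero = ≡.trans (≡.cong (λ z → m + z) (ℕ.0∸n≡0 m)) (ℕ.+-identityʳ m)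
  m+[n∸m]≡n+[m∸n] zero (suc n) = ≡.sym (ℕ.+-identityʳ (suc n))
  m+[n∸m]≡n+[m∸n] (suc m) (suc n) = ≡.cong suc (m+[n∸m]≡n+[m∸n] m n)

  halfPerimeter-∷ʳ : ∀ a r y → halfPerimeter a (r ∷ʳ y) ≡ halfPerimeter a r + suc (y ∸ lastLetter (a ∷ r))
  halfPerimeter-∷ʳ a [] y =
    ≡.cong (suc ∘ suc) (≡.trans (≡.cong suc (m+[n∸m]≡n+[m∸n] y a)) (≡.sym (ℕ.+-suc a (y ∸ a))))
  halfPerimeter-∷ʳ a (b ∷ r) y =
    ≡.trans (≡.cong (λ z → suc (z + (a ∸ b))) (halfPerimeter-∷ʳ b r y)) (regroup (halfPerimeter b r) _ (a ∸ b))
    where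
    regroup : ∀ P Q D → suc ((P + Q) + D) ≡ suc (P + D) + Q
    regroup = solve-∀

  sper-∷ʳ : ∀ x xs y → sper ((x ∷ xs) ∷ʳ y) ≡ sper (x ∷ xs) + suc (y ∸ lastLetter (x ∷ xs))
  sper-∷ʳ x xs y = begin
    sper ((x ∷ xs) ∷ʳ y)                                ≡⟨ sper-∷ x (xs ∷ʳ y) ⟩
    halfPerimeter x (xs ∷ʳ y)                           ≡⟨ halfPerimeter-∷ʳ x xs y ⟩
    halfPerimeter x xs + suc (y ∸ lastLetter (x ∷ xs))  ≡⟨ ≡.cong (_+ suc (y ∸ lastLetter (x ∷ xs))) (sper-∷ x xs) ⟨
    sper (x ∷ xs) + suc (y ∸ lastLetter (x ∷ xs))       ∎

module PowerSeriesRing {c ℓ} (R : CommutativeRing c ℓ) where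
  open CommutativeRing R hiding (zero)
  open Series R using (PowerSeries; _⊛_; quad)
  open FiniteSums R
  open import Algebra.Properties.CommutativeSemigroup +-commutativeSemigroup using (interchange)
  open import Relation.Binary.Reasoning.Setoid setoid

  infix 4 _≋_
  infixl 6 _+ₛ_ _-ₛ_
  infixl 7 _*ₛ_
  infix 8 -ₛ_

  _≋_ : PowerSeries → PowerSeries → Set ℓ
  f ≋ g = ∀ n → f n ≈ g n

  _+ₛ_ : PowerSeries → PowerSeries → PowerSeries
  (f +ₛ g) n = f n + g n

  -ₛ_ : PowerSeries → PowerSeries
  (-ₛ f) n = - f n

  _-ₛ_ : PowerSeries → PowerSeries → PowerSeries
  f -ₛ g = f +ₛ -ₛ g

  _*ₛ_ : PowerSeries → PowerSeries → PowerSeries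
  (f *ₛ g) zero = f 0 * g 0
  (f *ₛ g) (suc n) = f 0 * g (suc n) + ((f ∘ suc) *ₛ g) n

  constₛ : Carrier → PowerSeries
  constₛ a zero = a
  constₛ a (suc n) = 0#

  0ₛ 1ₛ X : PowerSeries
  0ₛ _ = 0#
  1ₛ = constₛ 1#
  X zero = 0#
  X (suc n) = 1ₛ n

  *ₛ-cong : ∀ {f f′ g g′} → f ≋ f′ → g ≋ g′ → f *ₛ g ≋ f′ *ₛ g′
  *ₛ-cong f≋f′ g≋g′ zero = *-cong (f≋f′ 0) (g≋g′ 0)
  *ₛ-cong f≋f′ g≋g′ (suc n) = +-cong (*-cong (f≋f′ 0) (g≋g′ (suc n))) (*ₛ-cong (f≋f′ ∘ suc) g≋g′ n)

  *ₛ-cong-≤ˡ : ∀ K {f f′} g → (∀ k → k ≤ K → f k ≈ f′ k) → ∀ n → n ≤ K → (f *ₛ g) n ≈ (f′ *ₛ g) n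
  *ₛ-cong-≤ˡ K g f≈f′ zero n≤K = *-congʳ (f≈f′ 0 n≤K)
  *ₛ-cong-≤ˡ (suc K) g f≈f′ (suc n) (s≤s n≤K) =
    +-cong (*-congʳ (f≈f′ 0 z≤n)) (*ₛ-cong-≤ˡ K g (λ k k≤K → f≈f′ (suc k) (s≤s k≤K)) n n≤K)

  *ₛ-cong-≤ʳ : ∀ K f {g g′} → (∀ k → k ≤ K → g k ≈ g′ k) → ∀ n → n ≤ K → (f *ₛ g) n ≈ (f *ₛ g′) n
  *ₛ-cong-≤ʳ K f g≈g′ zero n≤K = *-congˡ (g≈g′ 0 n≤K)
  *ₛ-cong-≤ʳ K f g≈g′ (suc n) n≤K =
    +-cong (*-congˡ (g≈g′ (suc n) n≤K)) (*ₛ-cong-≤ʳ K (f ∘ suc) g≈g′ n (ℕ.≤-trans (ℕ.n≤1+n n) n≤K))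

  *ₛ-distribʳ-+ₛ : ∀ h f g → (f +ₛ g) *ₛ h ≋ f *ₛ h +ₛ g *ₛ h
  *ₛ-distribʳ-+ₛ h f g zero = distribʳ _ _ _
  *ₛ-distribʳ-+ₛ h f g (suc n) =
    trans (+-cong (distribʳ _ _ _) (*ₛ-distribʳ-+ₛ h (f ∘ suc) (g ∘ suc) n)) (interchange _ _ _ _)

  *ₛ-distribˡ-+ₛ : ∀ f g h → f *ₛ (g +ₛ h) ≋ f *ₛ g +ₛ f *ₛ h
  *ₛ-distribˡ-+ₛ f g h zero = distribˡ _ _ _
  *ₛ-distribˡ-+ₛ f g h (suc n) =
    trans (+-cong (distribˡ _ _ _) (*ₛ-distribˡ-+ₛ (f ∘ suc) g h n)) (interchange _ _ _ _)

  *ₛ-scaleˡ : ∀ a f g n → ((λ i → a * f i) *ₛ g) n ≈ a * (f *ₛ g) n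
  *ₛ-scaleˡ a f g zero = *-assoc _ _ _
  *ₛ-scaleˡ a f g (suc n) = trans (+-cong (*-assoc _ _ _) (*ₛ-scaleˡ a (f ∘ suc) g n)) (sym (distribˡ _ _ _))

  *ₛ-last : ∀ f g n → (f *ₛ g) (suc n) ≈ (f *ₛ (g ∘ suc)) n + f (suc n) * g 0
  *ₛ-last f g zero = refl
  *ₛ-last f g (suc n) = trans (+-congˡ (*ₛ-last (f ∘ suc) g n)) (sym (+-assoc _ _ _))

  *ₛ-comm : ∀ f g → f *ₛ g ≋ g *ₛ f
  *ₛ-comm f g zero = *-comm _ _
  *ₛ-comm f g (suc n) = begin
    f 0 * g (suc n) + ((f ∘ suc) *ₛ g) n  ≈⟨ +-congˡ (*ₛ-comm (f ∘ suc) g n) ⟩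
    f 0 * g (suc n) + (g *ₛ (f ∘ suc)) n  ≈⟨ +-comm _ _ ⟩
    (g *ₛ (f ∘ suc)) n + f 0 * g (suc n)  ≈⟨ +-congˡ (*-comm _ _) ⟩
    (g *ₛ (f ∘ suc)) n + g (suc n) * f 0  ≈⟨ sym (*ₛ-last g f n) ⟩
    (g *ₛ f) (suc n)                      ∎

  *ₛ-assoc : ∀ f g h → (f *ₛ g) *ₛ h ≋ f *ₛ (g *ₛ h)
  *ₛ-assoc f g h zero = *-assoc _ _ _
  *ₛ-assoc f g h (suc n) = begin
    ((f *ₛ g) *ₛ h) (suc n)
      ≈⟨ *ₛ-cong {g = h} head+tail (λ _ → refl) (suc n) ⟩
    ((f0g +ₛ f′g′) *ₛ h) (suc n)
      ≈⟨ *ₛ-distribʳ-+ₛ h f0g f′g′ (suc n) ⟩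
    (f0g *ₛ h) (suc n) + (f′g′ *ₛ h) (suc n)
      ≈⟨ +-cong (*ₛ-scaleˡ (f 0) g h (suc n)) (trans (+-congʳ (zeroˡ _)) (+-identityˡ _)) ⟩
    f 0 * (g *ₛ h) (suc n) + (((f ∘ suc) *ₛ g) *ₛ h) n
      ≈⟨ +-congˡ (*ₛ-assoc (f ∘ suc) g h n) ⟩
    (f *ₛ (g *ₛ h)) (suc n)
      ∎
    where
    f0g f′g′ : PowerSeries
    f0g m = f 0 * g m
    f′g′ zero = 0#
    f′g′ (suc m) = ((f ∘ suc) *ₛ g) m
    head+tail : f *ₛ g ≋ f0g +ₛ f′g′
    head+tail zero = sym (+-identityʳ _)
    head+tail (suc m) = refl

  *ₛ-∑ : ∀ f M (G : ℕ → PowerSeries) n → (f *ₛ (λ k → ∑[ j < M ] G j k)) n ≈ ∑[ j < M ] (f *ₛ G j) n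
  *ₛ-∑ f M G zero = *-distribˡ-∑ M _ _
  *ₛ-∑ f M G (suc n) = trans (+-cong (*-distribˡ-∑ M _ _) (*ₛ-∑ (f ∘ suc) M G n)) (sym (∑-+ M _ _))

  constₛ-*ₛ : ∀ a g n → (constₛ a *ₛ g) n ≈ a * g n
  constₛ-*ₛ a g zero = refl
  constₛ-*ₛ a g (suc n) = trans (+-congˡ (0ₛ-*ₛ n)) (+-identityʳ _)
    where
    0ₛ-*ₛ : ∀ n → (0ₛ *ₛ g) n ≈ 0#
    0ₛ-*ₛ zero = zeroˡ _
    0ₛ-*ₛ (suc n) = trans (+-cong (zeroˡ _) (0ₛ-*ₛ n)) (+-identityʳ _)

  1ₛ-*ₛ : ∀ g → 1ₛ *ₛ g ≋ g
  1ₛ-*ₛ g n = trans (constₛ-*ₛ 1# g n) (*-identityˡ _)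

  X-*ₛ-zero : ∀ g → (X *ₛ g) 0 ≈ 0#
  X-*ₛ-zero g = zeroˡ _

  X-*ₛ-suc : ∀ g n → (X *ₛ g) (suc n) ≈ g n
  X-*ₛ-suc g n = trans (trans (+-congʳ (zeroˡ _)) (+-identityˡ _)) (1ₛ-*ₛ g n)

  ≋-X-*ₛ : ∀ {f} g → f 0 ≈ 0# → (∀ n → f (suc n) ≈ g n) → f ≋ X *ₛ g
  ≋-X-*ₛ g f₀≈0 f₊≈g zero = trans f₀≈0 (sym (X-*ₛ-zero g))
  ≋-X-*ₛ g f₀≈0 f₊≈g (suc n) = trans (f₊≈g n) (sym (X-*ₛ-suc g n))

  powerSeriesRing : CommutativeRing c ℓ
  powerSeriesRing = record
    { Carrier = PowerSeries
    ; _≈_ = _≋_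
    ; _+_ = _+ₛ_
    ; _*_ = _*ₛ_
    ; -_ = -ₛ_
    ; 0# = 0ₛ
    ; 1# = 1ₛ
    ; isCommutativeRing = record
      { isRing = record
        { +-isAbelianGroup = record
          { isGroup = record
            { isMonoid = record
              { isSemigroup = record
                { isMagma = record
                  { isEquivalence = record
                    { refl = λ _ → refl ; sym = λ f≋g n → sym (f≋g n) ; trans = λ f≋g g≋h n → trans (f≋g n) (g≋h n) }
                  ; ∙-cong = λ f≋f′ g≋g′ n → +-cong (f≋f′ n) (g≋g′ n) }
                ; assoc = λ f g h n → +-assoc _ _ _ }
              ; identity = (λ f n → +-identityˡ _) , (λ f n → +-identityʳ _) }
            ; inverse = (λ f n → -‿inverseˡ _) , (λ f n → -‿inverseʳ _)
            ; ⁻¹-cong = λ f≋g n → -‿cong (f≋g n) }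
          ; comm = λ f g n → +-comm _ _ }
        ; *-cong = *ₛ-cong
        ; *-assoc = *ₛ-assoc
        ; *-identity = 1ₛ-*ₛ , (λ g n → trans (*ₛ-comm g 1ₛ n) (1ₛ-*ₛ g n))
        ; distrib = *ₛ-distribˡ-+ₛ , *ₛ-distribʳ-+ₛ
        }
      ; *-comm = *ₛ-comm
      }
    }

  ⊛≈*ₛ : ∀ f g n → (f ⊛ g) n ≈ (f *ₛ g) n
  ⊛≈*ₛ f g n = trans (reflexive (sumR-upTo (λ k → f k * g (n ∸ k)) (suc n))) (∑≈*ₛ f n)
    where
    ∑≈*ₛ : ∀ f n → ∑[ k < suc n ] (f k * g (n ∸ k)) ≈ (f *ₛ g) n
    ∑≈*ₛ f zero = +-identityʳ _
    ∑≈*ₛ f (suc n) = +-congˡ (∑≈*ₛ (f ∘ suc) n)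

  quad≋ : ∀ a b e → quad a b e ≋ constₛ a +ₛ X *ₛ (constₛ b +ₛ X *ₛ constₛ e)
  quad≋ a b e zero = sym (trans (+-congˡ (X-*ₛ-zero (constₛ b +ₛ X *ₛ constₛ e))) (+-identityʳ a))
  quad≋ a b e (suc n) = sym (trans (+-identityˡ _) (trans (X-*ₛ-suc (constₛ b +ₛ X *ₛ constₛ e) n) (tail n)))
    where
    tail : ∀ n → (constₛ b +ₛ X *ₛ constₛ e) n ≈ quad a b e (suc n)
    tail zero = trans (+-congˡ (X-*ₛ-zero (constₛ e))) (+-identityʳ b)
    tail (suc n) = trans (+-identityˡ _) (trans (X-*ₛ-suc (constₛ e) n) (last n))
      where
      last : ∀ n → constₛ e n ≈ quad a b e (suc (suc n))
      last zero = refl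
      last (suc n) = refl

  constₛ-+ : ∀ a b → constₛ (a + b) ≋ constₛ a +ₛ constₛ b
  constₛ-+ a b zero = refl
  constₛ-+ a b (suc n) = sym (+-identityˡ 0#)

  constₛ-* : ∀ a b → constₛ (a * b) ≋ constₛ a *ₛ constₛ b
  constₛ-* a b n = sym (trans (constₛ-*ₛ a (constₛ b) n) (scaled n))
    where
    scaled : ∀ n → a * constₛ b n ≈ constₛ (a * b) n
    scaled zero = refl
    scaled (suc n) = zeroʳ a

  constₛ-neg : ∀ a → constₛ (- a) ≋ -ₛ constₛ a
  constₛ-neg a zero = refl
  constₛ-neg a (suc n) = sym -0#≈0#
    where open import Algebra.Properties.Ring ring using (-0#≈0#)

module Transfer {c ℓ} (R : CommutativeRing c ℓ) (p : CommutativeRing.Carrier R) where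
  open CommutativeRing R hiding (zero)
  open Series R using (PowerSeries; pow; sumR; Cgeq)
  open FiniteSums R
  open IntegerSolver R using (solve; _:=_; _:+_; _:*_)
  open Words
  open import Relation.Binary.Reasoning.Setoid setoid

  p² : Carrier
  p² = pow p 2

  -- upEnding n j and downEnding n j are the weights Σ p^sper(w) of the avoiders w of
  -- length n + 1 with last letter j whose last step is, respectively, not and is weakly
  -- descending (a one-letter word counts as not descending); ending j n is the weight of
  -- all avoiders of length n ending with j, i.e. ending j is the series c_j.
  mutual
    ending : ℕ → PowerSeries
    ending j zero = 0#
    ending j (suc n) = upEnding n j + downEnding n j

    upEnding : ℕ → ℕ → Carrier
    upEnding n (suc j) = p² * ending j n
    upEnding zero zero = p²
    upEnding (suc n) zero = 0#

    downEnding : ℕ → ℕ → Carrier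
    downEnding zero j = 0#
    downEnding (suc n) j = p * ∑[ i < suc n ] ([ j ≤ᵇ i ] * upEnding n i)

  pow-+ : ∀ a m n → pow a (m ℕ.+ n) ≈ pow a m * pow a n
  pow-+ a zero n = sym (*-identityˡ _)
  pow-+ a (suc m) n = trans (*-congˡ (pow-+ a m n)) (sym (*-assoc _ _ _))

  ∑Words : ℕ → ℕ → (List ℕ → Carrier) → Carrier
  ∑Words k b f = sumR (map f (listsOf k b))

  ∑Words-cong : ∀ k b {f g} → (∀ w → f w ≈ g w) → ∑Words k b f ≈ ∑Words k b g
  ∑Words-cong k b = sumR-cong (listsOf k b)

  ∑Words-∷ : ∀ k b f → ∑Words (suc k) b f ≈ ∑[ x < b ] ∑Words k b (λ w → f (x ∷ w))
  ∑Words-∷ k b f = begin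
    sumR (map f (concatMap (λ x → map (x ∷_) (listsOf k b)) (upTo b)))
      ≈⟨ sumR-concatMap f (λ x → map (x ∷_) (listsOf k b)) (upTo b) ⟩
    sumR (map (λ x → sumR (map f (map (x ∷_) (listsOf k b)))) (upTo b))
      ≈⟨ sumR-cong (upTo b) (λ x → reflexive (≡.cong sumR (≡.sym (map-∘ (listsOf k b))))) ⟩
    sumR (map (λ x → ∑Words k b (λ w → f (x ∷ w))) (upTo b))
      ≡⟨ sumR-upTo _ b ⟩
    ∑[ x < b ] ∑Words k b (λ w → f (x ∷ w))
      ∎
    where open import Data.List.Properties using (map-∘)

  ∑Words-∷ʳ : ∀ k b f → ∑Words (suc k) b f ≈ ∑Words k b (λ w → ∑[ y < b ] f (w ∷ʳ y))
  ∑Words-∷ʳ zero b f = trans (∑Words-∷ zero b f) (trans (∑-cong b (λ x → +-identityʳ _)) (sym (+-identityʳ _)))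
  ∑Words-∷ʳ (suc k) b f = begin
    ∑Words (suc (suc k)) b f                                  ≈⟨ ∑Words-∷ (suc k) b f ⟩
    ∑[ x < b ] ∑Words (suc k) b (λ w → f (x ∷ w))             ≈⟨ ∑-cong b (λ x → ∑Words-∷ʳ k b (λ w → f (x ∷ w))) ⟩
    ∑[ x < b ] ∑Words k b (λ w → ∑[ y < b ] f (x ∷ w ∷ʳ y))   ≈⟨ sym (∑Words-∷ k b _) ⟩
    ∑Words (suc k) b (λ w → ∑[ y < b ] f (w ∷ʳ y))            ∎

  -- Replacing v^(last letter) by an arbitrary ψ of the last letter and of the shape of the
  -- last step is what lets the induction on the length go through.
  weight : (ℕ → Bool → Carrier) → List ℕ → Carrier
  weight ψ w = [ isAvoider w ] * (pow p (sper w) * ψ (lastLetter w) (endsWeaklyDown w))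

  step : ℕ → (ℕ → Bool → Carrier) → ℕ → Bool → Carrier
  step b ψ l d = ∑[ y < b ] ([ appendable l d y ] * (pow p (suc (y ∸ l)) * ψ y (y ≤ᵇ l)))

  ∑-weight-∷ʳ : ∀ b ψ x xs → ∑[ y < b ] weight ψ ((x ∷ xs) ∷ʳ y) ≈ weight (step b ψ) (x ∷ xs)
  ∑-weight-∷ʳ b ψ x xs = begin
    ∑[ y < b ] weight ψ (w ∷ʳ y)                        ≈⟨ ∑-cong b extend ⟩
    ∑[ y < b ] ([ isAvoider w ] * (pow p (sper w) * t y)) ≈⟨ sym (*-distribˡ-∑ b _ _) ⟩
    [ isAvoider w ] * ∑[ y < b ] (pow p (sper w) * t y)   ≈⟨ *-congˡ (sym (*-distribˡ-∑ b _ _)) ⟩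
    weight (step b ψ) w                                   ∎
    where
    w = x ∷ xs
    l = lastLetter w
    a : ℕ → Bool
    a = appendable l (endsWeaklyDown w)
    t : ℕ → Carrier
    t y = [ a y ] * (pow p (suc (y ∸ l)) * ψ y (y ≤ᵇ l))
    extend : ∀ y → weight ψ (w ∷ʳ y) ≈ [ isAvoider w ] * (pow p (sper w) * t y)
    extend y = begin
      [ isAvoider (w ∷ʳ y) ] * (pow p (sper (w ∷ʳ y)) * ψ (lastLetter (w ∷ʳ y)) (endsWeaklyDown (w ∷ʳ y)))
        ≡⟨ ≡.cong₂ (λ l′ d → [ isAvoider (w ∷ʳ y) ] * (pow p (sper (w ∷ʳ y)) * ψ l′ d))
                   (lastLetter-∷ʳ x xs y) (endsWeaklyDown-∷ʳ x xs y) ⟩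
      [ isAvoider (w ∷ʳ y) ] * (pow p (sper (w ∷ʳ y)) * ψ y (y ≤ᵇ l))
        ≡⟨ ≡.cong₂ (λ q s → [ q ] * (pow p s * ψ y (y ≤ᵇ l))) (isAvoider-∷ʳ x xs y) (sper-∷ʳ x xs y) ⟩
      [ isAvoider w ∧ a y ] * (pow p (sper w ℕ.+ suc (y ∸ l)) * ψ y (y ≤ᵇ l))
        ≈⟨ *-cong ([∧] (isAvoider w) (a y)) (*-congʳ (pow-+ p (sper w) _)) ⟩
      ([ isAvoider w ] * [ a y ]) * ((pow p (sper w) * pow p (suc (y ∸ l))) * ψ y (y ≤ᵇ l))
        ≈⟨ solve 5 (λ A B E F G → (A :* B) :* ((E :* F) :* G) := A :* (E :* (B :* (F :* G)))) refl _ _ _ _ _ ⟩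
      [ isAvoider w ] * (pow p (sper w) * t y)
        ∎

  unit-ascent : ∀ (ψ : ℕ → Bool → Carrier) j →
                pow p (suc (suc j ∸ j)) * ψ (suc j) (suc j ≤ᵇ j) ≡ p² * ψ (suc j) false
  unit-ascent ψ j =
    ≡.cong₂ (λ e d → pow p (suc e) * ψ (suc j) d) (ℕ.m+n∸n≡m 1 j) (m≤n⇒1+n≤ᵇm≡false (ℕ.≤-refl {j}))

  step-after-down : ∀ b ψ j → suc j < b → step b ψ j true ≈ p² * ψ (suc j) false
  step-after-down b ψ j j<b =
    trans (∑-select-suc j b (λ y → pow p (suc (y ∸ j)) * ψ y (y ≤ᵇ j)) j<b) (reflexive (unit-ascent ψ j))

  step-after-up : ∀ b ψ j → suc (suc j) ≤ b →
                  step b ψ j false ≈ p² * ψ (suc j) false + p * ∑[ y < suc j ] ψ y true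
  step-after-up b ψ j j+1<b = begin
    step b ψ j false
      ≈⟨ ∑-cong b (λ y → *-congʳ (reflexive (≡.cong [_] (𝔹.∧-identityʳ (y ≤ᵇ suc j))))) ⟩
    ∑[ y < b ] ([ y ≤ᵇ suc j ] * g y)               ≈⟨ ∑-[≤ᵇ] (suc j) b g j+1<b ⟩
    ∑[ y < suc (suc j) ] g y                        ≈⟨ ∑-init-last (suc j) g ⟩
    ∑[ y < suc j ] g y + g (suc j)                  ≈⟨ +-cong (∑-cong-< (suc j) below) (reflexive (unit-ascent ψ j)) ⟩
    ∑[ y < suc j ] (p * ψ y true) + p² * ψ (suc j) false
                                                    ≈⟨ +-comm _ _ ⟩
    p² * ψ (suc j) false + ∑[ y < suc j ] (p * ψ y true)
                                                    ≈⟨ +-congˡ (sym (*-distribˡ-∑ (suc j) p (λ y → ψ y true))) ⟩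
    p² * ψ (suc j) false + p * ∑[ y < suc j ] ψ y true
                                                    ∎
    where
    g : ℕ → Carrier
    g y = pow p (suc (y ∸ j)) * ψ y (y ≤ᵇ j)
    below : ∀ y → y < suc j → g y ≈ p * ψ y true
    below y (s≤s y≤j) = trans
      (reflexive (≡.cong₂ (λ e d → pow p (suc e) * ψ y d)
                          (ℕ.m≤n⇒m∸n≡0 y≤j) (Equivalence.to 𝔹.T-≡ (ℕ.≤⇒≤ᵇ y≤j))))
      (*-congʳ (*-identityʳ p))

  ∑-downEnding : ∀ k (φ : ℕ → Carrier) →
    ∑[ y < suc (suc k) ] (downEnding (suc k) y * φ y) ≈ ∑[ i < suc k ] (upEnding k i * (p * ∑[ y < suc i ] φ y))
  ∑-downEnding k φ = begin
    ∑[ y < suc (suc k) ] (downEnding (suc k) y * φ y)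
      ≈⟨ ∑-cong (suc (suc k)) expand ⟩
    ∑[ y < suc (suc k) ] ∑[ i < suc k ] ([ y ≤ᵇ i ] * u i y)
      ≈⟨ ∑-swap (suc (suc k)) (suc k) (λ y i → [ y ≤ᵇ i ] * u i y) ⟩
    ∑[ i < suc k ] ∑[ y < suc (suc k) ] ([ y ≤ᵇ i ] * u i y)
      ≈⟨ ∑-cong-< (suc k) (λ i i<k+1 → ∑-[≤ᵇ] i (suc (suc k)) (u i) (ℕ.≤-trans i<k+1 (ℕ.n≤1+n _))) ⟩
    ∑[ i < suc k ] ∑[ y < suc i ] u i y
      ≈⟨ ∑-cong (suc k) (λ i → trans (sym (*-distribˡ-∑ (suc i) (upEnding k i) (λ y → p * φ y)))
                                     (*-congˡ (sym (*-distribˡ-∑ (suc i) p φ)))) ⟩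
    ∑[ i < suc k ] (upEnding k i * (p * ∑[ y < suc i ] φ y))
      ∎
    where
    u : ℕ → ℕ → Carrier
    u i y = upEnding k i * (p * φ y)
    expand : ∀ y → downEnding (suc k) y * φ y ≈ ∑[ i < suc k ] ([ y ≤ᵇ i ] * u i y)
    expand y = begin
      (p * ∑[ i < suc k ] ([ y ≤ᵇ i ] * upEnding k i)) * φ y
        ≈⟨ solve 3 (λ P S F → (P :* S) :* F := S :* (P :* F)) refl p _ (φ y) ⟩
      ∑[ i < suc k ] ([ y ≤ᵇ i ] * upEnding k i) * (p * φ y)
        ≈⟨ *-distribʳ-∑ (suc k) (p * φ y) (λ i → [ y ≤ᵇ i ] * upEnding k i) ⟩
      ∑[ i < suc k ] (([ y ≤ᵇ i ] * upEnding k i) * (p * φ y))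
        ≈⟨ ∑-cong (suc k) (λ i → *-assoc [ y ≤ᵇ i ] (upEnding k i) (p * φ y)) ⟩
      ∑[ i < suc k ] ([ y ≤ᵇ i ] * u i y)
        ∎

  step-reorganise : ∀ k b ψ → suc (suc k) ≤ b →
    ∑[ j < suc k ] (upEnding k j * step b ψ j false + downEnding k j * step b ψ j true) ≈
    ∑[ j < suc (suc k) ] (upEnding (suc k) j * ψ j false + downEnding (suc k) j * ψ j true)
  step-reorganise k b ψ k+2≤b = begin
    ∑[ j < suc k ] (upEnding k j * step b ψ j false + downEnding k j * step b ψ j true)
      ≈⟨ ∑-cong-< (suc k) regroup ⟩
    ∑[ j < suc k ] (upEnding (suc k) (suc j) * Ψ j + upEnding k j * (p * H j))
      ≈⟨ ∑-+ (suc k) (λ j → upEnding (suc k) (suc j) * Ψ j) (λ j → upEnding k j * (p * H j)) ⟩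
    ∑[ j < suc k ] (upEnding (suc k) (suc j) * Ψ j) + ∑[ j < suc k ] (upEnding k j * (p * H j))
      ≈⟨ +-cong (sym (trans (+-congʳ (zeroˡ _)) (+-identityˡ _))) (sym (∑-downEnding k (λ y → ψ y true))) ⟩
    ∑[ j < suc (suc k) ] (upEnding (suc k) j * ψ j false) + ∑[ j < suc (suc k) ] (downEnding (suc k) j * ψ j true)
      ≈⟨ sym (∑-+ (suc (suc k)) (λ j → upEnding (suc k) j * ψ j false) (λ j → downEnding (suc k) j * ψ j true)) ⟩
    ∑[ j < suc (suc k) ] (upEnding (suc k) j * ψ j false + downEnding (suc k) j * ψ j true)
      ∎
    where
    Ψ H : ℕ → Carrier
    Ψ j = ψ (suc j) false
    H j = ∑[ y < suc j ] ψ y true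
    regroup : ∀ j → j < suc k → upEnding k j * step b ψ j false + downEnding k j * step b ψ j true ≈
                                upEnding (suc k) (suc j) * Ψ j + upEnding k j * (p * H j)
    regroup j (s≤s j≤k) = begin
      upEnding k j * step b ψ j false + downEnding k j * step b ψ j true
        ≈⟨ +-cong (*-congˡ (step-after-up b ψ j j+2≤b)) (*-congˡ (step-after-down b ψ j j+2≤b)) ⟩
      upEnding k j * (p² * Ψ j + p * H j) + downEnding k j * (p² * Ψ j)
        ≈⟨ solve 6 (λ U D Q S T h → U :* (Q :* S :+ T :* h) :+ D :* (Q :* S) := (Q :* (U :+ D)) :* S :+ U :* (T :* h))
                 refl _ _ _ _ _ _ ⟩
      upEnding (suc k) (suc j) * Ψ j + upEnding k j * (p * H j)
        ∎
      where
      j+2≤b = ℕ.≤-trans (s≤s (s≤s j≤k)) k+2≤b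

  ∑Words-weight : ∀ k b → suc k ≤ b → ∀ ψ →
    ∑Words (suc k) b (weight ψ) ≈ ∑[ j < suc k ] (upEnding k j * ψ j false + downEnding k j * ψ j true)
  ∑Words-weight zero (suc b) _ ψ = trans (∑Words-∷ zero (suc b) (weight ψ))
    (+-cong (trans (+-identityʳ _) (trans (*-identityˡ _) (sym (trans (+-congˡ (zeroˡ _)) (+-identityʳ _)))))
            (∑-≈0 b (λ i _ → trans (+-identityʳ _) (zeroˡ _))))
  ∑Words-weight (suc k) b k+2≤b ψ = begin
    ∑Words (suc (suc k)) b (weight ψ)                         ≈⟨ ∑Words-∷ʳ (suc k) b (weight ψ) ⟩
    ∑Words (suc k) b (λ w → ∑[ y < b ] weight ψ (w ∷ʳ y))     ≈⟨ ∑Words-cong-∷ k b (∑-weight-∷ʳ b ψ) ⟩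
    ∑Words (suc k) b (weight (step b ψ))                      ≈⟨ ∑Words-weight k b (ℕ.≤-trans (ℕ.n≤1+n _) k+2≤b) (step b ψ) ⟩
    ∑[ j < suc k ] (upEnding k j * step b ψ j false + downEnding k j * step b ψ j true)
                                                              ≈⟨ step-reorganise k b ψ k+2≤b ⟩
    ∑[ j < suc (suc k) ] (upEnding (suc k) j * ψ j false + downEnding (suc k) j * ψ j true)
                                                              ∎
    where
    ∑Words-cong-∷ : ∀ k b {f g} → (∀ x xs → f (x ∷ xs) ≈ g (x ∷ xs)) → ∑Words (suc k) b f ≈ ∑Words (suc k) b g
    ∑Words-cong-∷ k b {f} {g} f≈g = begin
      ∑Words (suc k) b f                            ≈⟨ ∑Words-∷ k b f ⟩
      ∑[ x < b ] ∑Words k b (λ w → f (x ∷ w))       ≈⟨ ∑-cong b (λ x → ∑Words-cong k b (f≈g x)) ⟩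
      ∑[ x < b ] ∑Words k b (λ w → g (x ∷ w))       ≈⟨ sym (∑Words-∷ k b g) ⟩
      ∑Words (suc k) b g                            ∎

  Cgeq-ending : ∀ v n → Cgeq p v (suc n) ≈ ∑[ j < suc n ] (ending j (suc n) * pow v j)
  Cgeq-ending v n = begin
    Cgeq p v (suc n)
      ≈⟨ sumR-filterᵇ isAvoider (λ w → pow p (sper w) * pow v (lastLetter w)) (listsOf (suc n) (suc n)) ⟩
    ∑Words (suc n) (suc n) (weight (λ j _ → pow v j))
      ≈⟨ ∑Words-weight n (suc n) ℕ.≤-refl (λ j _ → pow v j) ⟩
    ∑[ j < suc n ] (upEnding n j * pow v j + downEnding n j * pow v j)
      ≈⟨ ∑-cong (suc n) (λ j → sym (distribʳ (pow v j) (upEnding n j) (downEnding n j))) ⟩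
    ∑[ j < suc n ] (ending j (suc n) * pow v j)
      ∎

module EndingRecurrence {c ℓ} (R : CommutativeRing c ℓ) (p : CommutativeRing.Carrier R) where
  open CommutativeRing R hiding (zero)
  open Series R using (PowerSeries)
  open FiniteSums R
  open PowerSeriesRing R
  open Transfer R p
  open IntegerSolver powerSeriesRing using (solve; _:=_; _:+_; _:*_)
  open import Relation.Binary.Reasoning.Setoid setoid

  E anyEnding anyUpEnding : PowerSeries
  E = ending 0
  anyEnding n = ∑[ j < n ] ending j n
  anyUpEnding zero = 0#
  anyUpEnding (suc n) = ∑[ j < suc n ] upEnding n j

  ending-≈0 : ∀ n m → n ≤ m → ending m n ≈ 0#
  ending-≈0 zero m _ = refl
  ending-≈0 (suc n) (suc m) (s≤s n≤m) =
    trans (+-cong (trans (*-congˡ (ending-≈0 n m n≤m)) (zeroʳ _)) (downEnding-≈0 n n≤m)) (+-identityʳ _)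
    where
    downEnding-≈0 : ∀ n → n ≤ m → downEnding n (suc m) ≈ 0#
    downEnding-≈0 zero _ = refl
    downEnding-≈0 (suc n) n+1≤m = trans (*-congˡ (∑-≈0 (suc n) vanish)) (zeroʳ p)
      where
      vanish : ∀ i → i < suc n → [ suc m ≤ᵇ i ] * upEnding n i ≈ 0#
      vanish i (s≤s i≤n) = trans (*-congʳ (reflexive (≡.cong [_] (m≤n⇒1+n≤ᵇm≡false i≤m)))) (zeroˡ (upEnding n i))
        where i≤m = ℕ.≤-trans i≤n (ℕ.≤-trans (ℕ.n≤1+n n) n+1≤m)

  anyUpEnding-eq : anyUpEnding ≋ X *ₛ (constₛ p² +ₛ constₛ p² *ₛ anyEnding)
  anyUpEnding-eq = ≋-X-*ₛ _ refl coeff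
    where
    coeff : ∀ n → anyUpEnding (suc n) ≈ (constₛ p² +ₛ constₛ p² *ₛ anyEnding) n
    coeff zero = +-congˡ (sym (zeroʳ p²))
    coeff (suc n) = +-congˡ (sym (trans (constₛ-*ₛ p² anyEnding (suc n)) (*-distribˡ-∑ (suc n) p² (λ j → ending j (suc n)))))

  E-eq : E ≋ X *ₛ (constₛ p² +ₛ constₛ p *ₛ anyUpEnding)
  E-eq = ≋-X-*ₛ _ refl coeff
    where
    coeff : ∀ n → E (suc n) ≈ (constₛ p² +ₛ constₛ p *ₛ anyUpEnding) n
    coeff zero = +-congˡ (sym (zeroʳ p))
    coeff (suc n) = +-congˡ (sym (trans (constₛ-*ₛ p anyUpEnding (suc n))
                                       (*-congˡ (∑-cong (suc n) (λ i → sym (*-identityˡ (upEnding n i)))))))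

  E-*ₛ : ∀ F n → (E *ₛ F) (suc (suc n)) ≈ p² * F (suc n) + p * (p² * F n) + p * (p² * (anyEnding *ₛ F) n)
  E-*ₛ F n = begin
    (E *ₛ F) (suc (suc n))
      ≈⟨ *ₛ-cong E-expanded (λ _ → refl) (suc (suc n)) ⟩
    ((X *ₛ (P² +ₛ P *ₛ (X *ₛ (P² +ₛ P² *ₛ anyEnding)))) *ₛ F) (suc (suc n))
      ≈⟨ solve 5 (λ x a b c f → (x :* (a :+ b :* (x :* (a :+ a :* c)))) :* f :=
                                x :* (a :* f) :+ x :* (x :* (b :* (a :* f))) :+ x :* (x :* (b :* (a :* (c :* f)))))
                 (λ _ → refl) X P² P anyEnding F (suc (suc n)) ⟩
    (X *ₛ (P² *ₛ F) +ₛ X *ₛ (X *ₛ (P *ₛ (P² *ₛ F))) +ₛ X *ₛ (X *ₛ (P *ₛ (P² *ₛ (anyEnding *ₛ F))))) (suc (suc n))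
      ≈⟨ +-cong (+-cong (trans (X-*ₛ-suc (P² *ₛ F) (suc n)) (constₛ-*ₛ p² F (suc n))) (twice F)) (twice (anyEnding *ₛ F)) ⟩
    p² * F (suc n) + p * (p² * F n) + p * (p² * (anyEnding *ₛ F) n)
      ∎
    where
    P P² : PowerSeries
    P = constₛ p
    P² = constₛ p²
    E-expanded : E ≋ X *ₛ (P² +ₛ P *ₛ (X *ₛ (P² +ₛ P² *ₛ anyEnding)))
    E-expanded k = trans (E-eq k) (*ₛ-cong (λ _ → refl) (λ i → +-congˡ (*ₛ-cong (λ _ → refl) anyUpEnding-eq i)) k)
    twice : ∀ G → (X *ₛ (X *ₛ (P *ₛ (P² *ₛ G)))) (suc (suc n)) ≈ p * (p² * G n)
    twice G = trans (X-*ₛ-suc _ (suc n)) (trans (X-*ₛ-suc _ n) (trans (constₛ-*ₛ p _ n) (*-congˡ (constₛ-*ₛ p² G n))))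

  *ₛ-anyEnding : ∀ f K → (f *ₛ anyEnding) K ≈ ∑[ i < K ] (f *ₛ ending i) K
  *ₛ-anyEnding f K = trans
    (*ₛ-cong-≤ʳ K f (λ n n≤K → sym (∑-extend n K n≤K (λ j n≤j → ending-≈0 n j n≤j))) K ℕ.≤-refl)
    (*ₛ-∑ f K ending K)

  -- The recurrence for ending (suc m) in degree n + 2 only involves coefficients of degree
  -- at most n, so c_{m+1} = E c_m is proved for all m at once by induction on the degree.
  EndingSucUpTo : ℕ → Set ℓ
  EndingSucUpTo K = ∀ m k → k ≤ K → ending (suc m) k ≈ (E *ₛ ending m) k

  ending-*ₛ : ∀ {K} → EndingSucUpTo K → ∀ i m k → k ≤ K → (ending i *ₛ ending m) k ≈ ending (suc (i ℕ.+ m)) k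
  ending-*ₛ hyp zero m k k≤K = sym (hyp m k k≤K)
  ending-*ₛ {K} hyp (suc i) m k k≤K = begin
    (ending (suc i) *ₛ ending m) k    ≈⟨ *ₛ-cong-≤ˡ K (ending m) (λ k′ k′≤K → hyp i k′ k′≤K) k k≤K ⟩
    ((E *ₛ ending i) *ₛ ending m) k   ≈⟨ *ₛ-assoc E (ending i) (ending m) k ⟩
    (E *ₛ (ending i *ₛ ending m)) k   ≈⟨ *ₛ-cong-≤ʳ K E (λ k′ k′≤K → ending-*ₛ hyp i m k′ k′≤K) k k≤K ⟩
    (E *ₛ ending (suc (i ℕ.+ m))) k   ≈⟨ sym (hyp (suc (i ℕ.+ m)) k k≤K) ⟩
    ending (suc (suc i ℕ.+ m)) k      ∎

  ∑-ending-from : ∀ K → EndingSucUpTo K → ∀ m → ∑[ i < K ] ending (m ℕ.+ i) K ≈ ending m K + (anyEnding *ₛ ending m) K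
  ∑-ending-from zero hyp m = sym (trans (+-identityˡ _) (zeroˡ _))
  ∑-ending-from (suc K) hyp m = begin
    ending (m ℕ.+ 0) (suc K) + ∑[ i < K ] ending (m ℕ.+ suc i) (suc K)
      ≈⟨ +-cong (reflexive (≡.cong (λ a → ending a (suc K)) (ℕ.+-identityʳ m)))
                (∑-cong K (λ i → reflexive (≡.cong (λ a → ending a (suc K))
                                                    (≡.trans (ℕ.+-suc m i) (≡.cong suc (ℕ.+-comm m i)))))) ⟩
    ending m (suc K) + ∑[ i < K ] ending (suc (i ℕ.+ m)) (suc K)
      ≈⟨ +-congˡ (sym (∑-extend K (suc K) (ℕ.n≤1+n K) vanish)) ⟩
    ending m (suc K) + ∑[ i < suc K ] ending (suc (i ℕ.+ m)) (suc K)
      ≈⟨ +-congˡ (∑-cong (suc K) (λ i → sym (ending-*ₛ hyp i m (suc K) ℕ.≤-refl))) ⟩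
    ending m (suc K) + ∑[ i < suc K ] (ending i *ₛ ending m) (suc K)
      ≈⟨ +-congˡ (∑-cong (suc K) (λ i → *ₛ-comm (ending i) (ending m) (suc K))) ⟩
    ending m (suc K) + ∑[ i < suc K ] (ending m *ₛ ending i) (suc K)
      ≈⟨ +-congˡ (sym (trans (*ₛ-comm anyEnding (ending m) (suc K)) (*ₛ-anyEnding (ending m) (suc K)))) ⟩
    ending m (suc K) + (anyEnding *ₛ ending m) (suc K)
      ∎
    where
    vanish : ∀ i → K ≤ i → ending (suc (i ℕ.+ m)) (suc K) ≈ 0#
    vanish i K≤i = ending-≈0 (suc K) (suc (i ℕ.+ m)) (s≤s (ℕ.≤-trans K≤i (ℕ.m≤m+n i m)))

  ending-suc-step : ∀ N → EndingSucUpTo N → ∀ m → ending (suc m) (suc N) ≈ (E *ₛ ending m) (suc N)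
  ending-suc-step zero hyp m =
    trans (trans (+-identityʳ _) (zeroʳ _)) (sym (trans (+-cong (zeroˡ _) (zeroʳ _)) (+-identityʳ _)))
  ending-suc-step (suc N) hyp m = begin
    p² * ending m (suc N) + p * ∑[ i < suc N ] ([ suc m ≤ᵇ i ] * upEnding N i)
      ≈⟨ +-congˡ (*-congˡ later) ⟩
    p² * ending m (suc N) + p * (p² * (ending m N + (anyEnding *ₛ ending m) N))
      ≈⟨ trans (+-congˡ (trans (*-congˡ (distribˡ p² _ _)) (distribˡ p _ _))) (sym (+-assoc _ _ _)) ⟩
    p² * ending m (suc N) + p * (p² * ending m N) + p * (p² * (anyEnding *ₛ ending m) N)
      ≈⟨ sym (E-*ₛ (ending m) N) ⟩
    (E *ₛ ending m) (suc (suc N))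
      ∎
    where
    later : ∑[ i < suc N ] ([ suc m ≤ᵇ i ] * upEnding N i) ≈ p² * (ending m N + (anyEnding *ₛ ending m) N)
    later = begin
      0# * upEnding N 0 + ∑[ i < N ] ([ suc m ≤ᵇ suc i ] * (p² * ending i N))
        ≈⟨ trans (+-congʳ (zeroˡ _)) (+-identityˡ _) ⟩
      ∑[ i < N ] ([ suc m ≤ᵇ suc i ] * (p² * ending i N))
        ≈⟨ ∑-cong N (λ i → *-congʳ (reflexive (≡.cong [_] (≤ᵇ-suc m i)))) ⟩
      ∑[ i < N ] ([ m ≤ᵇ i ] * (p² * ending i N))
        ≈⟨ ∑-[≥ᵇ] m N (λ i → p² * ending i N) (λ j N≤j → trans (*-congˡ (ending-≈0 N j N≤j)) (zeroʳ p²)) ⟩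
      ∑[ i < N ] (p² * ending (m ℕ.+ i) N)
        ≈⟨ sym (*-distribˡ-∑ N p² (λ i → ending (m ℕ.+ i) N)) ⟩
      p² * ∑[ i < N ] ending (m ℕ.+ i) N
        ≈⟨ *-congˡ (∑-ending-from N (λ m′ k k≤N → hyp m′ k (ℕ.≤-trans k≤N (ℕ.n≤1+n N))) m) ⟩
      p² * (ending m N + (anyEnding *ₛ ending m) N)
        ∎

  ending-suc-upTo : ∀ K → EndingSucUpTo K
  ending-suc-upTo zero m zero z≤n = sym (zeroˡ _)
  ending-suc-upTo (suc K) m k k≤K+1 with ℕ.m≤n⇒m<n∨m≡n k≤K+1
  ... | inj₁ (s≤s k≤K) = ending-suc-upTo K m k k≤K
  ... | inj₂ ≡.refl = ending-suc-step K (ending-suc-upTo K) m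

  ending-suc : ∀ m → ending (suc m) ≋ E *ₛ ending m
  ending-suc m n = ending-suc-upTo n m n ℕ.≤-refl

  anyEnding-eq : anyEnding ≋ E +ₛ E *ₛ anyEnding
  anyEnding-eq zero = sym (trans (+-identityˡ _) (zeroˡ _))
  anyEnding-eq (suc N) = begin
    E (suc N) + ∑[ j < N ] ending (suc j) (suc N)           ≈⟨ +-congˡ (∑-cong N (λ j → ending-suc j (suc N))) ⟩
    E (suc N) + ∑[ j < N ] (E *ₛ ending j) (suc N)          ≈⟨ +-congˡ (sym (∑-extend N (suc N) (ℕ.n≤1+n N) vanish)) ⟩
    E (suc N) + ∑[ j < suc N ] (E *ₛ ending j) (suc N)      ≈⟨ +-congˡ (sym (*ₛ-anyEnding E (suc N))) ⟩
    E (suc N) + (E *ₛ anyEnding) (suc N)                    ∎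
    where
    vanish : ∀ j → N ≤ j → (E *ₛ ending j) (suc N) ≈ 0#
    vanish j N≤j = trans (sym (ending-suc j (suc N))) (ending-≈0 (suc N) (suc j) (s≤s N≤j))

module FunctionalEquations {c ℓ} (R : CommutativeRing c ℓ) (p v : CommutativeRing.Carrier R) where
  open CommutativeRing R hiding (zero)
  open Series R using (PowerSeries; pow; Cgeq)
  open FiniteSums R
  open PowerSeriesRing R
  open Transfer R p
  open EndingRecurrence R p
  open IntegerSolver R using (solve; _:=_; _:+_; _:*_; _:-_; con)
  open import Relation.Binary.Reasoning.Setoid setoid

  C A B : PowerSeries
  C n = ∑[ j < n ] (ending j n * pow v j)
  A zero = 0#
  A (suc n) = ∑[ j < suc n ] (upEnding n j * pow v j)
  B zero = 0#
  B (suc n) = ∑[ j < suc n ] (downEnding n j * pow v j)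

  Cgeq≋C : Cgeq p v ≋ C
  Cgeq≋C zero = refl
  Cgeq≋C (suc n) = Cgeq-ending v n

  C≋A+B : C ≋ A +ₛ B
  C≋A+B zero = sym (+-identityˡ 0#)
  C≋A+B (suc n) = trans (∑-cong (suc n) (λ j → distribʳ (pow v j) (upEnding n j) (downEnding n j)))
                        (∑-+ (suc n) (λ j → upEnding n j * pow v j) (λ j → downEnding n j * pow v j))

  A-eq : A ≋ X *ₛ (constₛ p² +ₛ constₛ (p² * v) *ₛ C)
  A-eq = ≋-X-*ₛ _ refl coeff
    where
    coeff : ∀ n → A (suc n) ≈ (constₛ p² +ₛ constₛ (p² * v) *ₛ C) n
    coeff zero = trans (+-identityʳ _) (trans (*-identityʳ p²) (sym (trans (+-congˡ (zeroʳ _)) (+-identityʳ p²))))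
    coeff (suc n) = begin
      0# * 1# + ∑[ j < suc n ] ((p² * ending j (suc n)) * (v * pow v j))
        ≈⟨ +-cong (zeroˡ 1#) (∑-cong (suc n) (λ j → solve 4 (λ a b x w → (a :* x) :* (b :* w) := (a :* b) :* (x :* w))
                                                                 refl p² v (ending j (suc n)) (pow v j))) ⟩
      0# + ∑[ j < suc n ] ((p² * v) * (ending j (suc n) * pow v j))
        ≈⟨ +-congˡ (sym (*-distribˡ-∑ (suc n) (p² * v) (λ j → ending j (suc n) * pow v j))) ⟩
      0# + (p² * v) * C (suc n)
        ≈⟨ +-congˡ (sym (constₛ-*ₛ (p² * v) C (suc n))) ⟩
      0# + (constₛ (p² * v) *ₛ C) (suc n)
        ∎

  geometric-sum : ∀ i → (1# - v) * ∑[ j < suc i ] pow v j ≈ 1# - v * pow v i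
  geometric-sum zero = solve 1 (λ v → (con (+ 1) :- v) :* (con (+ 1) :+ con (+ 0)) := con (+ 1) :- v :* con (+ 1)) refl v
  geometric-sum (suc i) = begin
    (1# - v) * ∑[ j < suc (suc i) ] pow v j               ≈⟨ *-congˡ (∑-init-last (suc i) (pow v)) ⟩
    (1# - v) * (∑[ j < suc i ] pow v j + v * pow v i)     ≈⟨ distribˡ _ _ _ ⟩
    (1# - v) * ∑[ j < suc i ] pow v j + (1# - v) * (v * pow v i)
                                                          ≈⟨ +-congʳ (geometric-sum i) ⟩
    (1# - v * pow v i) + (1# - v) * (v * pow v i)         ≈⟨ solve 2 (λ v w → (con (+ 1) :- v :* w) :+ (con (+ 1) :- v) :* (v :* w)
                                                                         := con (+ 1) :- v :* (v :* w)) refl v (pow v i) ⟩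
    1# - v * (v * pow v i)                                ∎

  [1-v]*B : ∀ n → (1# - v) * B (suc (suc n)) ≈ p * (anyUpEnding (suc n) - v * A (suc n))
  [1-v]*B n = begin
    (1# - v) * ∑[ y < suc (suc n) ] (downEnding (suc n) y * pow v y)
      ≈⟨ *-congˡ (∑-downEnding n (pow v)) ⟩
    (1# - v) * ∑[ i < suc n ] (upEnding n i * (p * ∑[ y < suc i ] pow v y))
      ≈⟨ *-distribˡ-∑ (suc n) (1# - v) (λ i → upEnding n i * (p * ∑[ y < suc i ] pow v y)) ⟩
    ∑[ i < suc n ] ((1# - v) * (upEnding n i * (p * ∑[ y < suc i ] pow v y)))
      ≈⟨ ∑-cong (suc n) (λ i → solve 4 (λ u a q x → u :* (a :* (q :* x)) := q :* (a :* (u :* x)))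
                                      refl (1# - v) (upEnding n i) p (∑[ y < suc i ] pow v y)) ⟩
    ∑[ i < suc n ] (p * (upEnding n i * ((1# - v) * ∑[ y < suc i ] pow v y)))
      ≈⟨ ∑-cong (suc n) (λ i → *-congˡ {p} (*-congˡ {upEnding n i} (geometric-sum i))) ⟩
    ∑[ i < suc n ] (p * (upEnding n i * (1# - v * pow v i)))
      ≈⟨ ∑-cong (suc n) (λ i → solve 4 (λ q a v w → q :* (a :* (con (+ 1) :- v :* w)) := q :* (a :- v :* (a :* w)))
                                      refl p (upEnding n i) v (pow v i)) ⟩
    ∑[ i < suc n ] (p * (upEnding n i - v * (upEnding n i * pow v i)))
      ≈⟨ sym (*-distribˡ-∑ (suc n) p (λ i → upEnding n i - v * (upEnding n i * pow v i))) ⟩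
    p * ∑[ i < suc n ] (upEnding n i - v * (upEnding n i * pow v i))
      ≈⟨ *-congˡ (∑-+ (suc n) (upEnding n) (λ i → - (v * (upEnding n i * pow v i)))) ⟩
    p * (anyUpEnding (suc n) + ∑[ i < suc n ] (- (v * (upEnding n i * pow v i))))
      ≈⟨ *-congˡ (+-congˡ (sym (trans (-‿cong (*-distribˡ-∑ (suc n) v (λ i → upEnding n i * pow v i)))
                                        (-‿distrib-∑ (suc n) (λ i → v * (upEnding n i * pow v i)))))) ⟩
    p * (anyUpEnding (suc n) - v * A (suc n))
      ∎

  B-eq : constₛ (1# - v) *ₛ B ≋ X *ₛ (constₛ p *ₛ (anyUpEnding -ₛ constₛ v *ₛ A))
  B-eq = ≋-X-*ₛ _ (zeroʳ _) coeff
    where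
    rhs : ∀ n → (constₛ p *ₛ (anyUpEnding -ₛ constₛ v *ₛ A)) n ≈ p * (anyUpEnding n - v * A n)
    rhs n = trans (constₛ-*ₛ p _ n) (*-congˡ (+-congˡ (-‿cong (constₛ-*ₛ v A n))))
    coeff : ∀ n → (constₛ (1# - v) *ₛ B) (suc n) ≈ (constₛ p *ₛ (anyUpEnding -ₛ constₛ v *ₛ A)) n
    coeff zero = trans (constₛ-*ₛ (1# - v) B 1) (trans (*-congˡ (trans (+-identityʳ _) (zeroˡ _)))
      (trans (zeroʳ _) (sym (trans (rhs 0) (solve 2 (λ p v → p :* (con (+ 0) :- v :* con (+ 0)) := con (+ 0)) refl p v)))))
    coeff (suc n) = trans (constₛ-*ₛ (1# - v) B (suc (suc n))) (trans ([1-v]*B n) (sym (rhs (suc n))))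

module ClosedForm {c ℓ} (R : CommutativeRing c ℓ) (p v : CommutativeRing.Carrier R) where
  open CommutativeRing R hiding (zero)
  open Series R using (PowerSeries; quad; numer; denom; radicand)
  open PowerSeriesRing R
  open EndingRecurrence R p using (E; anyEnding; anyUpEnding; E-eq; anyUpEnding-eq; anyEnding-eq)
  open FunctionalEquations R p v using (C; A; B; C≋A+B; A-eq; B-eq)
  private module ₛ = CommutativeRing powerSeriesRing
  open import Algebra.Properties.AbelianGroup ₛ.+-abelianGroup using (x≈y⇒x∙y⁻¹≈ε)
  open IntegerSolver powerSeriesRing using (solve; _:=_; _:+_; _:*_; _:-_; :-_; con; Polynomial)

  -- Terms in p and v: evaluated in R they give the coefficients of numer, denom and radicand
  -- definitionally, evaluated in the power-series ring they are what the ring solver sees.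
  infixl 6 _‵+_
  infixl 7 _‵*_
  infix 8 ‵-_

  data Term : Set where
    ‵p ‵v ‵1 : Term
    _‵+_ _‵*_ : Term → Term → Term
    ‵-_ : Term → Term

  ⟦_⟧ : Term → Carrier
  ⟦ ‵p ⟧ = p
  ⟦ ‵v ⟧ = v
  ⟦ ‵1 ⟧ = 1#
  ⟦ s ‵+ t ⟧ = ⟦ s ⟧ + ⟦ t ⟧
  ⟦ s ‵* t ⟧ = ⟦ s ⟧ * ⟦ t ⟧
  ⟦ ‵- t ⟧ = - ⟦ t ⟧

  ⟦_⟧ₛ : Term → PowerSeries
  ⟦ ‵p ⟧ₛ = constₛ p
  ⟦ ‵v ⟧ₛ = constₛ v
  ⟦ ‵1 ⟧ₛ = 1ₛ
  ⟦ s ‵+ t ⟧ₛ = ⟦ s ⟧ₛ +ₛ ⟦ t ⟧ₛ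
  ⟦ s ‵* t ⟧ₛ = ⟦ s ⟧ₛ *ₛ ⟦ t ⟧ₛ
  ⟦ ‵- t ⟧ₛ = -ₛ ⟦ t ⟧ₛ

  constₛ-⟦⟧ : ∀ t → constₛ ⟦ t ⟧ ≋ ⟦ t ⟧ₛ
  constₛ-⟦⟧ ‵p n = refl
  constₛ-⟦⟧ ‵v n = refl
  constₛ-⟦⟧ ‵1 n = refl
  constₛ-⟦⟧ (s ‵+ t) n = trans (constₛ-+ ⟦ s ⟧ ⟦ t ⟧ n) (+-cong (constₛ-⟦⟧ s n) (constₛ-⟦⟧ t n))
  constₛ-⟦⟧ (s ‵* t) n = trans (constₛ-* ⟦ s ⟧ ⟦ t ⟧ n) (*ₛ-cong (constₛ-⟦⟧ s) (constₛ-⟦⟧ t) n)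
  constₛ-⟦⟧ (‵- t) n = trans (constₛ-neg ⟦ t ⟧ n) (-‿cong (constₛ-⟦⟧ t n))

  poly : ∀ {m} → Polynomial m → Polynomial m → Term → Polynomial m
  poly P V ‵p = P
  poly P V ‵v = V
  poly P V ‵1 = con (+ 1)
  poly P V (s ‵+ t) = poly P V s :+ poly P V t
  poly P V (s ‵* t) = poly P V s :* poly P V t
  poly P V (‵- t) = :- poly P V t

  ‵2 ‵p² ‵p³ ‵p⁴ ‵v² ‵1-v : Term
  ‵2 = ‵1 ‵+ ‵1
  ‵p² = ‵p ‵* (‵p ‵* ‵1)
  ‵p³ = ‵p ‵* ‵p²
  ‵p⁴ = ‵p ‵* ‵p³
  ‵v² = ‵v ‵* (‵v ‵* ‵1)
  ‵1-v = ‵1 ‵+ ‵- ‵v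

  quadₜ : Term → Term → Term → PowerSeries
  quadₜ a b e = ⟦ a ⟧ₛ +ₛ X *ₛ (⟦ b ⟧ₛ +ₛ X *ₛ ⟦ e ⟧ₛ)

  quad-⟦⟧ : ∀ a b e → quad ⟦ a ⟧ ⟦ b ⟧ ⟦ e ⟧ ≋ quadₜ a b e
  quad-⟦⟧ a b e n = trans (quad≋ ⟦ a ⟧ ⟦ b ⟧ ⟦ e ⟧ n)
    (ₛ.+-cong (constₛ-⟦⟧ a) (ₛ.*-congˡ (ₛ.+-cong (constₛ-⟦⟧ b) (ₛ.*-congˡ (constₛ-⟦⟧ e)))) n)

  numer₁ numer₂ denom₀ denom₁ denom₂ radicand₁ radicand₂ : Term
  numer₁ = (‵1 ‵+ ‵- (‵2 ‵* ‵v)) ‵* ‵p²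
  numer₂ = ‵- (‵2 ‵* ‵v ‵* ‵p³)
  denom₀ = ‵2 ‵* ‵1-v
  denom₁ = ‵- (‵2 ‵* (‵p² ‵* ‵v ‵* ‵1-v))
  denom₂ = ‵2 ‵* (‵p³ ‵* ‵v²)
  radicand₁ = ‵- (‵2 ‵* ‵p²)
  radicand₂ = ‵p⁴ ‵+ ‵- (‵2 ‵* ‵2 ‵* ‵p³)

  numerₛ denomₛ radicandₛ : PowerSeries
  numerₛ = quadₜ ‵1 numer₁ numer₂
  denomₛ = quadₜ denom₀ denom₁ denom₂
  radicandₛ = quadₜ ‵1 radicand₁ radicand₂

  numer≋ : numer p v ≋ numerₛ
  numer≋ = quad-⟦⟧ ‵1 numer₁ numer₂

  denom≋ : denom p v ≋ denomₛ
  denom≋ = quad-⟦⟧ denom₀ denom₁ denom₂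

  radicand≋ : radicand p v ≋ radicandₛ
  radicand≋ = quad-⟦⟧ ‵1 radicand₁ radicand₂

  P V P² U 2ₛ : PowerSeries
  P = ⟦ ‵p ⟧ₛ
  V = ⟦ ‵v ⟧ₛ
  P² = ⟦ ‵p² ⟧ₛ
  U = ⟦ ‵1-v ⟧ₛ
  2ₛ = 1ₛ +ₛ 1ₛ

  S : PowerSeries
  S = 1ₛ +ₛ P *ₛ (P *ₛ X) -ₛ 2ₛ *ₛ E

  resC resA resB resE resU resAny : PowerSeries
  resC = C -ₛ (A +ₛ B)
  resA = A -ₛ X *ₛ (P² +ₛ ⟦ ‵p² ‵* ‵v ⟧ₛ *ₛ C)
  resB = U *ₛ B -ₛ X *ₛ (P *ₛ (anyUpEnding -ₛ V *ₛ A))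
  resE = E -ₛ X *ₛ (P² +ₛ P *ₛ anyUpEnding)
  resU = anyUpEnding -ₛ X *ₛ (P² +ₛ P² *ₛ anyEnding)
  resAny = anyEnding -ₛ (E +ₛ E *ₛ anyEnding)

  resC≋0 : resC ≋ 0ₛ
  resC≋0 = x≈y⇒x∙y⁻¹≈ε C≋A+B

  resA≋0 : resA ≋ 0ₛ
  resA≋0 =
    x≈y⇒x∙y⁻¹≈ε (ₛ.trans A-eq (ₛ.*-congˡ (ₛ.+-cong (constₛ-⟦⟧ ‵p²) (ₛ.*-congʳ (constₛ-⟦⟧ (‵p² ‵* ‵v))))))

  resB≋0 : resB ≋ 0ₛ
  resB≋0 = x≈y⇒x∙y⁻¹≈ε (ₛ.trans (ₛ.*-congʳ (ₛ.sym (constₛ-⟦⟧ ‵1-v))) B-eq)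

  resE≋0 : resE ≋ 0ₛ
  resE≋0 = x≈y⇒x∙y⁻¹≈ε (ₛ.trans E-eq (ₛ.*-congˡ (ₛ.+-congʳ (constₛ-⟦⟧ ‵p²))))

  resU≋0 : resU ≋ 0ₛ
  resU≋0 =
    x≈y⇒x∙y⁻¹≈ε (ₛ.trans anyUpEnding-eq (ₛ.*-congˡ (ₛ.+-cong (constₛ-⟦⟧ ‵p²) (ₛ.*-congʳ (constₛ-⟦⟧ ‵p²)))))

  resAny≋0 : resAny ≋ 0ₛ
  resAny≋0 = x≈y⇒x∙y⁻¹≈ε anyEnding-eq

  c₀ c₁ c₂ : ∀ {m} → Polynomial m
  c₀ = con (+ 0)
  c₁ = con (+ 1)
  c₂ = c₁ :+ c₁

  quadP : ∀ {m} → Polynomial m → Polynomial m → Polynomial m → Polynomial m → Polynomial m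
  quadP x a b e = a :+ x :* (b :+ x :* e)

  denom-C : denomₛ *ₛ C ≋ numerₛ -ₛ S
  denom-C = begin
    denomₛ *ₛ C
      ≈⟨ solve 8 (λ P V X C A B U₁ E →
             let t = poly P V
                 u = t ‵1-v
                 s = c₁ :+ P :* (P :* X) :- c₂ :* E
                 hC = C :- (A :+ B)
                 hA = A :- X :* (t ‵p² :+ t (‵p² ‵* ‵v) :* C)
                 hB = u :* B :- X :* (P :* (U₁ :- V :* A))
                 hE = E :- X :* (t ‵p² :+ P :* U₁)
             in quadP X (t denom₀) (t denom₁) (t denom₂) :* C :=
                (quadP X c₁ (t numer₁) (t numer₂) :- s) :- (c₂ :* hE :- c₂ :* (u :* hC :+ hB :+ (u :- X :* P :* V) :* hA)))
           (λ _ → refl) P V X C A B anyUpEnding E ⟩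
    (numerₛ -ₛ S) -ₛ (2ₛ *ₛ resE -ₛ 2ₛ *ₛ (U *ₛ resC +ₛ resB +ₛ W *ₛ resA))
      ≈⟨ ₛ.+-congˡ (ₛ.-‿cong (ₛ.+-cong (ₛ.*-congˡ resE≋0)
           (ₛ.-‿cong (ₛ.*-congˡ (ₛ.+-cong (ₛ.+-cong (ₛ.*-congˡ resC≋0) resB≋0) (ₛ.*-congˡ resA≋0)))))) ⟩
    (numerₛ -ₛ S) -ₛ (2ₛ *ₛ 0ₛ -ₛ 2ₛ *ₛ (U *ₛ 0ₛ +ₛ 0ₛ +ₛ W *ₛ 0ₛ))
      ≈⟨ solve 3 (λ x u w → x :- (c₂ :* c₀ :- c₂ :* (u :* c₀ :+ c₀ :+ w :* c₀)) := x) (λ _ → refl) (numerₛ -ₛ S) U W ⟩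
    numerₛ -ₛ S
      ∎
    where
    open import Relation.Binary.Reasoning.Setoid ₛ.setoid
    W : PowerSeries
    W = U -ₛ X *ₛ P *ₛ V

  S-square : S *ₛ S ≋ radicandₛ
  S-square = begin
    S *ₛ S
      ≈⟨ solve 5 (λ P X E U₁ Any →
             let p² = P :* (P :* c₁)
                 hE = E :- X :* (p² :+ P :* U₁)
                 hU = U₁ :- X :* (p² :+ p² :* Any)
                 hAny = Any :- (E :+ E :* Any)
                 s = c₁ :+ P :* (P :* X) :- c₂ :* E
             in s :* s := quadP X c₁ (poly P P radicand₁) (poly P P radicand₂)
                          :+ c₂ :* c₂ :* ((hE :+ P :* X :* hU) :* (E :- c₁) :- P :* P :* P :* X :* X :* hAny))
           (λ _ → refl) P X E anyUpEnding anyEnding ⟩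
    radicandₛ +ₛ 2ₛ *ₛ 2ₛ *ₛ ((resE +ₛ P *ₛ X *ₛ resU) *ₛ (E -ₛ 1ₛ) -ₛ P³X² *ₛ resAny)
      ≈⟨ ₛ.+-congˡ (ₛ.*-congˡ (ₛ.+-cong (ₛ.*-congʳ (ₛ.+-cong resE≋0 (ₛ.*-congˡ resU≋0)))
                                        (ₛ.-‿cong (ₛ.*-congˡ resAny≋0)))) ⟩
    radicandₛ +ₛ 2ₛ *ₛ 2ₛ *ₛ ((0ₛ +ₛ P *ₛ X *ₛ 0ₛ) *ₛ (E -ₛ 1ₛ) -ₛ P³X² *ₛ 0ₛ)
      ≈⟨ solve 5 (λ r P X E K → r :+ c₂ :* c₂ :* ((c₀ :+ P :* X :* c₀) :* (E :- c₁) :- K :* c₀) := r)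
               (λ _ → refl) radicandₛ P X E P³X² ⟩
    radicandₛ
      ∎
    where
    open import Relation.Binary.Reasoning.Setoid ₛ.setoid
    P³X² : PowerSeries
    P³X² = P *ₛ P *ₛ P *ₛ X *ₛ X

  S-zero : S 0 ≈ 1#
  S-zero = trans (+-cong (trans (+-congˡ (trans (*-congˡ (zeroʳ p)) (zeroʳ p))) (+-identityʳ 1#))
                         (trans (-‿cong (zeroʳ _)) -0#≈0#))
                 (+-identityʳ 1#)
    where open import Algebra.Properties.Ring ring using (-0#≈0#)

theorem3p2 : ∀ {c ℓ : Level} (R : CommutativeRing c ℓ) (p v : CommutativeRing.Carrier R) →
    let open CommutativeRing R
        open Series R
    in Σ PowerSeries λ S →
         (S 0 ≈ 1#)
         × (∀ n → (S ⊛ S) n ≈ radicand p v n)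
         × (∀ n → (denom p v ⊛ Cgeq p v) n ≈ (numer p v ⊝ S) n)
theorem3p2 R p v = S , S-zero , square , product
  where
  open CommutativeRing R
  open Series R
  open PowerSeriesRing R using (_*ₛ_; _-ₛ_; *ₛ-cong; ⊛≈*ₛ)
  open FunctionalEquations R p v using (C; Cgeq≋C)
  open ClosedForm R p v
  open import Relation.Binary.Reasoning.Setoid setoid

  square : ∀ n → (S ⊛ S) n ≈ radicand p v n
  square n = trans (⊛≈*ₛ S S n) (trans (S-square n) (sym (radicand≋ n)))

  product : ∀ n → (denom p v ⊛ Cgeq p v) n ≈ (numer p v ⊝ S) n
  product n = begin
    (denom p v ⊛ Cgeq p v) n               ≈⟨ ⊛≈*ₛ (denom p v) (Cgeq p v) n ⟩
    (denom p v *ₛ Cgeq p v) n              ≈⟨ *ₛ-cong denom≋ Cgeq≋C n ⟩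
    (denomₛ *ₛ C) n                        ≈⟨ denom-C n ⟩
    (numerₛ -ₛ S) n                        ≈⟨ +-congʳ (sym (numer≋ n)) ⟩
    (numer p v ⊝ S) n                      ∎
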